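{- Let $X=\mathcal{M}_O(n,a,b)$ be feasible with $a>1$, and suppose $[v_0,v_a]\in\mathcal{G}$. Then $X$ admits an automorphism of order $2$ that maps $\mathcal{G}$ onto $\mathcal{R}$ and $\mathcal{R}$ onto $\mathcal{G}$ if and only if $8\mid n$, $b=4b_0+1<(3n-4)/4$ with $b_0$ odd, $4b_0^2\equiv 4\pmod n$, and $a=b-n/2+2$.
   Context: For even $n\ge4$ and odd $0<a<b<n$, $\mathcal{M}_O(n,a,b)$ has vertices $u_0,\dots,u_{n-1},v_0,\dots,v_{n-1}$ and edges $[u_i,u_{i+1}]$, $[u_i,v_i]$ for all $i$ and $[v_i,v_{i+a}]$, $[v_i,v_{i+b}]$ for even $i$ (subscripts mod $n$). It is feasible if $\gcd(b-a,n)=2$, $(b-a)^2/2\equiv 2\pmod n$, at least one of $a+(a-1)(a-b)/2\equiv1$ or $b+(b-1)(b-a)/2\equiv 1\pmod n$ holds, and $1\le a<b-2<n-a-2$. Let $x=a$ if $a+(a-1)(a-b)/2\equiv 1\pmod n$ and $x=b$ otherwise, and $y$ the other element of $\{a,b\}$. $\mathcal{R}=\{[u_i,v_i]\}$; $\mathcal{B}=\{[u_i,u_{i+1}]: i\text{ even}\}\cup\{[v_j,v_{j+x}]: j\text{ even}\}$; $\mathcal{G}=\{[u_i,u_{i+1}]: i\text{ odd}\}\cup\{[v_j,v_{j+y}]: j\text{ even}\}$. -}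

module Defs where

open import Data.Nat as ℕ using (ℕ; zero; suc; _+_; _*_; _∸_; _<_; _≤_; NonZero)
open import Data.Nat.DivMod using (_mod_; _%_; _/_)
open import Data.Nat.GCD using (gcd)
import Data.Nat.Divisibility as ℕD
open import Data.Fin using (Fin; toℕ)
open import Data.Integer as ℤ using (ℤ; +_; -_)
open import Data.Integer.Divisibility as ℤD using ()
open import Data.Product using (Σ; ∃; _×_; _,_)
open import Data.Sum using (_⊎_)
open import Data.Unit using (⊤)
open import Relation.Binary.PropositionalEquality using (_≡_; _≢_)
open import Relation.Nullary using (Dec; yes; no; ¬_)
open import Function.Bundles using (_⇔_)

Even : ℕ → Set
Even i = i % 2 ≡ 0

Odd : ℕ → Set
Odd i = i % 2 ≡ 1

infix 4 _≡_[mod_]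
_≡_[mod_] : ℤ → ℤ → ℕ → Set
x ≡ y [mod n ] = (+ n) ℤD.∣ (x ℤ.- y)

_≡?_[mod_] : (x y : ℤ) (n : ℕ) → Dec (x ≡ y [mod n ])
x ≡? y [mod n ] = n ℕD.∣? ℤ.∣ x ℤ.- y ∣

-- a + (a-1)(a-b)/2 ≡ 1 (mod n); note (a-1)(a-b)/2 = -((a-1)(b-a)/2) as a < b
CondA : ℕ → ℕ → ℕ → Set
CondA n a b = (+ a ℤ.+ (- + (((a ∸ 1) * (b ∸ a)) / 2))) ≡ + 1 [mod n ]

CondB : ℕ → ℕ → ℕ → Set
CondB n a b = (+ (b + ((b ∸ 1) * (b ∸ a)) / 2)) ≡ + 1 [mod n ]

Feasible : ℕ → ℕ → ℕ → Set
Feasible n a b =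
  Even n × 4 ≤ n × Odd a × Odd b × 0 < a × a < b × b < n ×
  (gcd (b ∸ a) n ≡ 2) ×
  ((+ (((b ∸ a) * (b ∸ a)) / 2)) ≡ + 2 [mod n ]) ×
  (CondA n a b ⊎ CondB n a b) ×
  1 ≤ a × a < b ∸ 2 × b ∸ 2 < n ∸ a ∸ 2

xPar : ℕ → ℕ → ℕ → ℕ
xPar n a b with (+ a ℤ.+ (- + (((a ∸ 1) * (b ∸ a)) / 2))) ≡? + 1 [mod n ]
... | yes _ = a
... | no _ = b

yPar : ℕ → ℕ → ℕ → ℕ
yPar n a b with (+ a ℤ.+ (- + (((a ∸ 1) * (b ∸ a)) / 2))) ≡? + 1 [mod n ]
... | yes _ = b
... | no _ = a

-- The graph M_O(n,a,b): vertices u_i = (U , i), v_i = (V , i), i ∈ ℤ_n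

data Side : Set where
  U V : Side

Vertex : ℕ → Set
Vertex n = Side × Fin n

Sym : {A : Set} → (A → A → Set) → A → A → Set
Sym R x y = R x y ⊎ R y x

module MO (n a b : ℕ) .{{_ : NonZero n}} where

  _⊕_ : Fin n → ℕ → Fin n
  i ⊕ k = (toℕ i + k) mod n

  RimD : (ℕ → Set) → Vertex n → Vertex n → Set
  RimD P x y = ∃ λ (i : Fin n) → P (toℕ i) × x ≡ (U , i) × y ≡ (U , i ⊕ 1)

  SpokeD : Vertex n → Vertex n → Set
  SpokeD x y = ∃ λ (i : Fin n) → x ≡ (U , i) × y ≡ (V , i)

  InnerD : ℕ → Vertex n → Vertex n → Set
  InnerD k x y = ∃ λ (j : Fin n) → Even (toℕ j) × x ≡ (V , j) × y ≡ (V , j ⊕ k)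

  Adj : Vertex n → Vertex n → Set
  Adj = Sym (λ x y → RimD (λ _ → ⊤) x y ⊎ SpokeD x y ⊎ InnerD a x y ⊎ InnerD b x y)

  Rset : Vertex n → Vertex n → Set
  Rset = Sym SpokeD

  Bset : Vertex n → Vertex n → Set
  Bset = Sym (λ x y → RimD Even x y ⊎ InnerD (xPar n a b) x y)

  Gset : Vertex n → Vertex n → Set
  Gset = Sym (λ x y → RimD Odd x y ⊎ InnerD (yPar n a b) x y)

  record Automorphism : Set where
    field
      f      : Vertex n → Vertex n
      f⁻¹    : Vertex n → Vertex n
      left   : ∀ x → f⁻¹ (f x) ≡ x
      right  : ∀ x → f (f⁻¹ x) ≡ x
      adj    : ∀ x y → Adj x y ⇔ Adj (f x) (f y)

  HasOrder2 : Automorphism → Set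
  HasOrder2 φ = (∀ x → f (f x) ≡ x) × (∃ λ x → f x ≢ x)
    where open Automorphism φ

  MapsOnto : Automorphism → (Vertex n → Vertex n → Set) → (Vertex n → Vertex n → Set) → Set
  MapsOnto φ E F = ∀ x y → E x y ⇔ F (f x) (f y)
    where open Automorphism φ

  v0 : Vertex n
  v0 = (V , 0 mod n)

  vAt : ℕ → Vertex n
  vAt k = (V , k mod n)

{-# OPTIONS --safe #-}
-- R, B and G are perfect matchings, so an automorphism exchanging R and G fixes B and is
-- determined by how it intertwines the three matchings. Lift M_O(n,a,b) to a cover on Side × ℤ.
-- The rim walk blue-green-blue-green from u₄ₖ to u₄ₖ₊₄ is carried to blue-red-blue-red, a translation
-- by ±σ with σ = 1 - b, so f(u₄ₖ) is the k-th translate of f(u₀). Comparing the images of pairs of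
-- walks with a common end forces 4 ∣ n, b ≡ 1 and a ≡ 3 (mod 4), and three congruences modulo n which
-- are equivalent to the stated arithmetic. Conversely, under these conditions the map sending
-- u_{4k+r} and v_{4k+r} (0 ≤ r < 4) to fixed positions translated by kσ is well defined modulo n,
-- exchanges red and green, preserves blue, and is an involution because the graph is connected.
module Submission where

open import Defs
open import Data.Bool using (Bool; true; false; not; _xor_)
open import Data.Empty using (⊥; ⊥-elim)
open import Data.Fin using (Fin; toℕ; fromℕ<)
import Data.Fin.Properties as Finₚ
open import Data.Integer using (ℤ; +_; -[1+_]; -_; _-_; _+_; _*_)
import Data.Integer as ℤ
import Data.Integer.Properties as ℤₚ
open import Data.Integer.DivMod using (_%ℕ_; _/ℕ_; n%ℕd<d; a≡a%ℕn+[a/ℕn]*n)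
import Data.Integer.Divisibility.Signed as ℤ∣
open import Data.Integer.Tactic.RingSolver using (solve-∀)
open import Data.List using (List; []; _∷_; map)
import Data.Nat as ℕ
open ℕ using (ℕ; zero; suc; NonZero; z≤n; s≤s)
import Data.Nat.Properties as ℕₚ
import Data.Nat.DivMod as ℕ
import Data.Nat.Divisibility as ℕ∣
import Data.Nat.Tactic.RingSolver as ℕ-Solver
open import Data.Nat.Divisibility using (_∣_; divides)
open import Data.Product using (∃; _×_; _,_; proj₁; proj₂)
open import Data.Sum using (_⊎_; inj₁; inj₂; [_,_]′) renaming (map to ⊎-map; swap to ⊎-swap)
open import Data.Unit using (⊤; tt)
open import Function.Bundles using (_⇔_; mk⇔; Equivalence)
open import Function.Base using (_∘_)
open import Relation.Binary.PropositionalEquality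
open import Relation.Nullary using (¬_; yes; no)

open ℤ∣ using (divides) renaming (_∣_ to _∣ᶻ_)

remainder-unique : ∀ {r₁ r₂ d : ℕ} (k : ℤ) → r₁ ℕ.< d → r₂ ℕ.< d → + r₁ ≡ + r₂ + k * + d → r₁ ≡ r₂
remainder-unique {r₁} {r₂} {d} (+ zero) _ _ eq = ℤₚ.+-injective (trans eq (ℤₚ.+-identityʳ (+ r₂)))
remainder-unique {r₁} {r₂} {d} (+ suc j) r₁<d _ eq = ⊥-elim (ℕₚ.<⇒≱ r₁<d d≤r₁)
  where
  r₁≡ : r₁ ≡ r₂ ℕ.+ suc j ℕ.* d
  r₁≡ = ℤₚ.+-injective (trans eq (cong (λ u → + r₂ + u) (sym (ℤₚ.pos-* (suc j) d))))
  d≤r₁ : d ℕ.≤ r₁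
  d≤r₁ rewrite r₁≡ = ℕₚ.≤-trans (ℕₚ.m≤m+n d (j ℕ.* d)) (ℕₚ.m≤n+m (suc j ℕ.* d) r₂)
remainder-unique {r₁} {r₂} {d} -[1+ j ] _ r₂<d eq = ⊥-elim (ℕₚ.<⇒≱ r₂<d d≤r₂)
  where
  swap-sides : ∀ y k d → y ≡ (y + (- k) * d) + k * d
  swap-sides = solve-∀
  r₂≡ : r₂ ≡ r₁ ℕ.+ suc j ℕ.* d
  r₂≡ = ℤₚ.+-injective (trans (swap-sides (+ r₂) (+ suc j) (+ d))
          (trans (cong (_+ + suc j * + d) (sym eq)) (cong (λ u → + r₁ + u) (sym (ℤₚ.pos-* (suc j) d)))))
  d≤r₂ : d ℕ.≤ r₂
  d≤r₂ rewrite r₂≡ = ℕₚ.≤-trans (ℕₚ.m≤m+n d (j ℕ.* d)) (ℕₚ.m≤n+m (suc j ℕ.* d) r₁)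

+-%-/ : ∀ t d .{{_ : NonZero d}} → + t ≡ + (t ℕ.% d) + + (t ℕ./ d) * + d
+-%-/ t d = trans (cong +_ (ℕ.m≡m%n+[m/n]*n t d))
              (trans (ℤₚ.pos-+ (t ℕ.% d) _) (cong (λ u → + (t ℕ.% d) + u) (ℤₚ.pos-* (t ℕ./ d) d)))

%-unique : ∀ {t e d} .{{_ : NonZero d}} (k : ℤ) → e ℕ.< d → + t ≡ + e + k * + d → t ℕ.% d ≡ e
%-unique {t} {e} {d} k e<d eq =
  remainder-unique (k - + (t ℕ./ d)) (ℕ.m%n<n t d) e<d (begin
    + (t ℕ.% d)                                   ≡⟨ isolate (+ (t ℕ.% d)) (+ (t ℕ./ d)) (+ d) ⟩
    (+ (t ℕ.% d) + + (t ℕ./ d) * + d) - + (t ℕ./ d) * + d ≡⟨ cong (λ u → u - + (t ℕ./ d) * + d) (trans (sym (+-%-/ t d)) eq) ⟩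
    (+ e + k * + d) - + (t ℕ./ d) * + d            ≡⟨ regroup (+ e) k (+ (t ℕ./ d)) (+ d) ⟩
    + e + (k - + (t ℕ./ d)) * + d                  ∎)
  where
  open ≡-Reasoning
  isolate : ∀ r q d → r ≡ (r + q * d) - q * d
  isolate = solve-∀
  regroup : ∀ e k q d → (e + k * d) - q * d ≡ e + (k - q) * d
  regroup = solve-∀

divMod-unique : ∀ {t r d} .{{_ : NonZero d}} (k : ℤ) → r ℕ.< d → + t ≡ + r + k * + d →
                t ℕ.% d ≡ r × + (t ℕ./ d) ≡ k
divMod-unique {t} {r} {d} k r<d t≡ = t%d≡r , ℤₚ.*-cancelʳ-≡ (+ (t ℕ./ d)) k (+ d) (begin
    + (t ℕ./ d) * + d                             ≡⟨ isolate (+ r) (+ (t ℕ./ d) * + d) ⟩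
    (+ r + + (t ℕ./ d) * + d) - + r               ≡⟨ cong (λ u → u + + (t ℕ./ d) * + d - + r) (cong +_ (sym t%d≡r)) ⟩
    (+ (t ℕ.% d) + + (t ℕ./ d) * + d) - + r       ≡⟨ cong (_- + r) (trans (sym (+-%-/ t d)) t≡) ⟩
    (+ r + k * + d) - + r                         ≡⟨ sym (isolate (+ r) (k * + d)) ⟩
    k * + d                                       ∎)
  where
  open ≡-Reasoning
  t%d≡r : t ℕ.% d ≡ r
  t%d≡r = %-unique k r<d t≡
  isolate : ∀ r u → u ≡ (r + u) - r
  isolate = solve-∀

divisor-unique : ∀ {c d} → c ∣ d → 0 ℕ.< d → d ℕ.< c ℕ.+ c → d ≡ c
divisor-unique (divides zero refl) () _
divisor-unique {c} (divides (suc zero) refl) _ _ = ℕₚ.+-identityʳ c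
divisor-unique {c} (divides (suc (suc q)) refl) _ d<c+c =
  ⊥-elim (ℕₚ.<⇒≱ d<c+c (ℕₚ.+-monoʳ-≤ c (ℕₚ.m≤m+n c (q ℕ.* c))))

Evenℤ : ℤ → Set
Evenℤ z = + 2 ∣ᶻ z

record Oddℤ (z : ℤ) : Set where
  constructor odd-by
  field 2∣z-1 : + 2 ∣ᶻ z - + 1

even+even : ∀ {x y} → Evenℤ x → Evenℤ y → Evenℤ (x + y)
even+even = ℤ∣.∣m∣n⇒∣m+n

even+odd : ∀ {x y} → Evenℤ x → Oddℤ y → Oddℤ (x + y)
even+odd {x} {y} ex (odd-by oy) = odd-by (subst (+ 2 ∣ᶻ_) (assoc x y) (ℤ∣.∣m∣n⇒∣m+n ex oy))
  where assoc : ∀ x y → x + (y - + 1) ≡ x + y - + 1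
        assoc = solve-∀

odd+even : ∀ {x y} → Oddℤ x → Evenℤ y → Oddℤ (x + y)
odd+even {x} {y} ox ey = subst Oddℤ (ℤₚ.+-comm y x) (even+odd ey ox)

odd+odd : ∀ {x y} → Oddℤ x → Oddℤ y → Evenℤ (x + y)
odd+odd {x} {y} (odd-by ox) (odd-by oy) =
  subst (+ 2 ∣ᶻ_) (regroup x y) (ℤ∣.∣m∣n⇒∣m+n (ℤ∣.∣m∣n⇒∣m+n ox oy) ℤ∣.∣-refl)
  where regroup : ∀ x y → (x - + 1) + (y - + 1) + + 2 ≡ x + y
        regroup = solve-∀

neg-even : ∀ {x} → Evenℤ x → Evenℤ (- x)
neg-even = ℤ∣.∣m⇒∣-m

neg-odd : ∀ {x} → Oddℤ x → Oddℤ (- x)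
neg-odd {x} (odd-by ox) = odd-by (subst (+ 2 ∣ᶻ_) (regroup x) (ℤ∣.∣m∣n⇒∣m-n (ℤ∣.∣m⇒∣-m ox) ℤ∣.∣-refl))
  where regroup : ∀ x → - (x - + 1) - + 2 ≡ - x - + 1
        regroup = solve-∀

1-odd : Oddℤ (+ 1)
1-odd = odd-by (divides (+ 0) refl)

%2≡0⇒even : ∀ t → t ℕ.% 2 ≡ 0 → Evenℤ (+ t)
%2≡0⇒even t t%2≡0 = divides (+ (t ℕ./ 2))
  (trans (+-%-/ t 2) (trans (cong (λ r → + r + + (t ℕ./ 2) * + 2) t%2≡0) (ℤₚ.+-identityˡ _)))

%2≡1⇒odd : ∀ t → t ℕ.% 2 ≡ 1 → Oddℤ (+ t)
%2≡1⇒odd t t%2≡1 = odd-by (divides (+ (t ℕ./ 2)) (begin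
  + t - + 1                          ≡⟨ cong (_- + 1) (+-%-/ t 2) ⟩
  + (t ℕ.% 2) + + (t ℕ./ 2) * + 2 - + 1 ≡⟨ cong (λ r → + r + + (t ℕ./ 2) * + 2 - + 1) t%2≡1 ⟩
  + 1 + + (t ℕ./ 2) * + 2 - + 1        ≡⟨ cancel (+ (t ℕ./ 2) * + 2) ⟩
  + (t ℕ./ 2) * + 2                    ∎))
  where
  open ≡-Reasoning
  cancel : ∀ u → + 1 + u - + 1 ≡ u
  cancel = solve-∀

%2≡0⊎%2≡1 : ∀ t → t ℕ.% 2 ≡ 0 ⊎ t ℕ.% 2 ≡ 1
%2≡0⊎%2≡1 t with t ℕ.% 2 | ℕ.m%n<n t 2
... | 0 | _ = inj₁ refl
... | 1 | _ = inj₂ refl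
... | suc (suc _) | s≤s (s≤s ())

even⇒%2≡0 : ∀ {t} → Evenℤ (+ t) → t ℕ.% 2 ≡ 0
even⇒%2≡0 (divides q t≡) = %-unique q (s≤s z≤n) (trans t≡ (sym (ℤₚ.+-identityˡ _)))

odd⇒%2≡1 : ∀ {t} → Oddℤ (+ t) → t ℕ.% 2 ≡ 1
odd⇒%2≡1 {t} (odd-by (divides q t-1≡)) = %-unique q (s≤s (s≤s z≤n)) (begin
  + t                  ≡⟨ shift (+ t) ⟩
  + 1 + (+ t - + 1)    ≡⟨ cong (λ u → + 1 + u) t-1≡ ⟩
  + 1 + q * + 2        ∎)
  where
  open ≡-Reasoning
  shift : ∀ t → t ≡ + 1 + (t - + 1)
  shift = solve-∀

odd⇒%4≡1⊎%4≡3 : ∀ t → t ℕ.% 2 ≡ 1 → t ℕ.% 4 ≡ 1 ⊎ t ℕ.% 4 ≡ 3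
odd⇒%4≡1⊎%4≡3 t t-odd with t ℕ.% 4 | ℕ.m%n<n t 4 | ℕ.m∣n⇒o%n%m≡o%m 2 4 t (divides 2 refl)
... | 0 | _ | r%2≡t%2 with () ← trans r%2≡t%2 t-odd
... | 1 | _ | _ = inj₁ refl
... | 2 | _ | r%2≡t%2 with () ← trans r%2≡t%2 t-odd
... | 3 | _ | _ = inj₂ refl
... | suc (suc (suc (suc _))) | s≤s (s≤s (s≤s (s≤s ()))) | _

signed : Bool → ℤ → ℤ
signed false z = z
signed true z = - z

signed-zero : ∀ q → signed q (+ 0) ≡ + 0
signed-zero false = refl
signed-zero true = refl

signed-even : ∀ q {x} → Evenℤ x → Evenℤ (signed q x)
signed-even false ex = ex
signed-even true ex = neg-even ex

module Modulo (n : ℕ) .{{_ : NonZero n}} where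

  infix 4 _≋_
  record _≋_ (x y : ℤ) : Set where
    constructor ≋-from-∣
    field n∣x-y : + n ∣ᶻ x - y

  ≋-reflexive : ∀ {x y} → x ≡ y → x ≋ y
  ≋-reflexive {x} refl = ≋-from-∣ (divides (+ 0) (ℤₚ.+-inverseʳ x))

  ≋-refl : ∀ {x} → x ≋ x
  ≋-refl = ≋-reflexive refl

  ≋-sym : ∀ {x y} → x ≋ y → y ≋ x
  ≋-sym {x} {y} (≋-from-∣ x≋y) = ≋-from-∣ (subst (+ n ∣ᶻ_) (negate x y) (ℤ∣.∣m⇒∣-m x≋y))
    where negate : ∀ x y → - (x - y) ≡ y - x
          negate = solve-∀

  ≋-trans : ∀ {x y z} → x ≋ y → y ≋ z → x ≋ z
  ≋-trans {x} {y} {z} (≋-from-∣ x≋y) (≋-from-∣ y≋z) =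
    ≋-from-∣ (subst (+ n ∣ᶻ_) (telescope x y z) (ℤ∣.∣m∣n⇒∣m+n x≋y y≋z))
    where telescope : ∀ x y z → (x - y) + (y - z) ≡ x - z
          telescope = solve-∀

  ≋-+ : ∀ {x y u v} → x ≋ y → u ≋ v → x + u ≋ y + v
  ≋-+ {x} {y} {u} {v} (≋-from-∣ x≋y) (≋-from-∣ u≋v) =
    ≋-from-∣ (subst (+ n ∣ᶻ_) (regroup x y u v) (ℤ∣.∣m∣n⇒∣m+n x≋y u≋v))
    where regroup : ∀ x y u v → (x - y) + (u - v) ≡ (x + u) - (y + v)
          regroup = solve-∀

  ≋-cancelˡ : ∀ {x p q} → x + p ≋ x + q → p ≋ q
  ≋-cancelˡ {x} {p} {q} (≋-from-∣ eq) = ≋-from-∣ (subst (+ n ∣ᶻ_) (cancel x p q) eq)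
    where cancel : ∀ x p q → (x + p) - (x + q) ≡ p - q
          cancel = solve-∀

  ≋-neg : ∀ {x y} → - x ≋ - y → x ≋ y
  ≋-neg {x} {y} (≋-from-∣ -x≋-y) = ≋-from-∣ (subst (+ n ∣ᶻ_) (negate x y) (ℤ∣.∣m⇒∣-m -x≋-y))
    where negate : ∀ x y → - (- x - - y) ≡ x - y
          negate = solve-∀

  ≋-multiple : ∀ {x y P} c → + n ∣ᶻ P → x - y ≡ c * P → x ≋ y
  ≋-multiple c n∣P eq = ≋-from-∣ (subst (+ n ∣ᶻ_) (sym eq) (ℤ∣.∣n⇒∣m*n c n∣P))

  ≋0⇒∣ : ∀ {x} → x ≋ + 0 → + n ∣ᶻ x
  ≋0⇒∣ {x} (≋-from-∣ n∣x-0) = subst (+ n ∣ᶻ_) (ℤₚ.+-identityʳ x) n∣x-0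

  signed-cancel : ∀ q {x y} → signed q x ≋ signed q y → x ≋ y
  signed-cancel false x≋y = x≋y
  signed-cancel true -x≋-y = ≋-neg -x≋-y

  signed-∣ : ∀ q {P} → + n ∣ᶻ signed q P → + n ∣ᶻ P
  signed-∣ false n∣P = n∣P
  signed-∣ true {P} n∣-P = subst (+ n ∣ᶻ_) (ℤₚ.neg-involutive P) (ℤ∣.∣m⇒∣-m n∣-P)

  difference-∣ : ∀ q {x y P} → x ≋ y → x - y ≡ signed q P → + n ∣ᶻ P
  difference-∣ q (≋-from-∣ n∣x-y) eq = signed-∣ q (subst (+ n ∣ᶻ_) eq n∣x-y)

  %ℕ-cong : ∀ {x y} → x ≋ y → x %ℕ n ≡ y %ℕ n
  %ℕ-cong {x} {y} (≋-from-∣ (divides q x-y≡)) =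
    remainder-unique (q + y /ℕ n - x /ℕ n) (n%ℕd<d x n) (n%ℕd<d y n) (begin
      + (x %ℕ n)                                  ≡⟨ isolate rx ry qx qy N ⟩
      (rx + qx * N) - (ry + qy * N) + ry + (qy - qx) * N
        ≡⟨ cong₂ (λ u v → u - v + ry + (qy - qx) * N) (sym (a≡a%ℕn+[a/ℕn]*n x n)) (sym (a≡a%ℕn+[a/ℕn]*n y n)) ⟩
      x - y + ry + (qy - qx) * N                  ≡⟨ cong (λ u → u + ry + (qy - qx) * N) x-y≡ ⟩
      q * N + ry + (qy - qx) * N                  ≡⟨ regroup ry q qx qy N ⟩
      + (y %ℕ n) + (q + qy - qx) * N              ∎)
    where
    open ≡-Reasoning
    N rx ry qx qy : ℤ
    N = + n
    rx = + (x %ℕ n)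
    ry = + (y %ℕ n)
    qx = x /ℕ n
    qy = y /ℕ n
    isolate : ∀ rx ry qx qy N → rx ≡ ((rx + qx * N) - (ry + qy * N)) + ry + (qy - qx) * N
    isolate = solve-∀
    regroup : ∀ ry q qx qy N → q * N + ry + (qy - qx) * N ≡ ry + (q + qy - qx) * N
    regroup = solve-∀

  ≋-<⇒≡ : ∀ {x y} → x ℕ.< n → y ℕ.< n → + x ≋ + y → x ≡ y
  ≋-<⇒≡ x<n y<n x≋y = trans (sym (ℕ.m<n⇒m%n≡m x<n)) (trans (%ℕ-cong x≋y) (ℕ.m<n⇒m%n≡m y<n))

  reduce : ℤ → Fin n
  reduce z = fromℕ< (n%ℕd<d z n)

  toℕ-reduce : ∀ z → toℕ (reduce z) ≡ z %ℕ n
  toℕ-reduce z = Finₚ.toℕ-fromℕ< (n%ℕd<d z n)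

  reduce-cong : ∀ {x y} → x ≋ y → reduce x ≡ reduce y
  reduce-cong {x} {y} x≋y = Finₚ.toℕ-injective (trans (toℕ-reduce x) (trans (%ℕ-cong x≋y) (sym (toℕ-reduce y))))

  toℕ-reduce-≋ : ∀ z → + toℕ (reduce z) ≋ z
  toℕ-reduce-≋ z = ≋-from-∣ (divides (- (z /ℕ n)) (begin
    + toℕ (reduce z) - z                         ≡⟨ cong₂ _-_ (cong +_ (toℕ-reduce z)) (a≡a%ℕn+[a/ℕn]*n z n) ⟩
    + (z %ℕ n) - (+ (z %ℕ n) + (z /ℕ n) * + n)   ≡⟨ cancel (+ (z %ℕ n)) (z /ℕ n) (+ n) ⟩
    - (z /ℕ n) * + n                             ∎))
    where
    open ≡-Reasoning
    cancel : ∀ r q N → r - (r + q * N) ≡ - q * N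
    cancel = solve-∀

  reduce-injective : ∀ {x y} → reduce x ≡ reduce y → x ≋ y
  reduce-injective {x} {y} eq =
    ≋-trans (≋-sym (toℕ-reduce-≋ x)) (≋-trans (≋-reflexive (cong (λ i → + toℕ i) eq)) (toℕ-reduce-≋ y))

  reduce-toℕ : ∀ (i : Fin n) → reduce (+ toℕ i) ≡ i
  reduce-toℕ i = Finₚ.toℕ-injective (trans (toℕ-reduce (+ toℕ i)) (ℕ.m<n⇒m%n≡m (Finₚ.toℕ<n i)))

  ≋⇒≡[mod] : ∀ {x y} → x ≋ y → x ≡ y [mod n ]
  ≋⇒≡[mod] (≋-from-∣ n∣x-y) = ℤ∣.∣⇒∣ᵤ n∣x-y

data Colour : Set where
  red blue green : Colour

swap : Colour → Colour
swap red = green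
swap blue = blue
swap green = red

swap-involutive : ∀ c → swap (swap c) ≡ c
swap-involutive red = refl
swap-involutive blue = refl
swap-involutive green = refl

flip : Side → Side
flip U = V
flip V = U

flip≢ : ∀ S → flip S ≢ S
flip≢ U ()
flip≢ V ()

isV : Side → Bool
isV U = false
isV V = true

isOdd : ℕ → Bool
isOdd t = t ℕ.% 2 ℕ.≡ᵇ 1

-- A position in the cover of M_O(n,a,b) by the graph on Side × ℤ; the flag records the parity
-- of the coordinate, which decides the direction of the blue and green edges.
record Pos : Set where
  constructor ⟨_,_,_⟩
  field
    side : Side
    odd : Bool
    coord : ℤ

open Pos

module Cover (n a b : ℕ) .{{_ : NonZero n}} (n-even : Evenℤ (+ n))
             (a-odd : Oddℤ (+ a)) (b-odd : Oddℤ (+ b)) where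

  open Modulo n public
  open MO n a b

  blueStride greenStride : Side → ℤ
  blueStride U = + 1
  blueStride V = + b
  greenStride U = - + 1
  greenStride V = + a

  move : Colour → Pos → Pos
  move red ⟨ S , p , z ⟩ = ⟨ flip S , p , z ⟩
  move blue ⟨ S , p , z ⟩ = ⟨ S , not p , z + signed p (blueStride S) ⟩
  move green ⟨ S , p , z ⟩ = ⟨ S , not p , z + signed p (greenStride S) ⟩

  σ : ℤ
  σ = + 1 - + b

  σ-even : Evenℤ σ
  σ-even = odd+odd 1-odd (neg-odd b-odd)

  Consistent : Pos → Set
  Consistent ⟨ _ , false , z ⟩ = Evenℤ z
  Consistent ⟨ _ , true , z ⟩ = Oddℤ z

  consistent-stride : ∀ S p z {k} → Consistent ⟨ S , p , z ⟩ → Oddℤ k →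
                      Consistent ⟨ S , not p , z + signed p k ⟩
  consistent-stride S false z ez ok = even+odd ez ok
  consistent-stride S true z oz ok = odd+odd oz (neg-odd ok)

  consistent-move : ∀ c s → Consistent s → Consistent (move c s)
  consistent-move red ⟨ S , false , z ⟩ cs = cs
  consistent-move red ⟨ S , true , z ⟩ cs = cs
  consistent-move blue ⟨ U , p , z ⟩ cs = consistent-stride U p z cs 1-odd
  consistent-move blue ⟨ V , p , z ⟩ cs = consistent-stride V p z cs b-odd
  consistent-move green ⟨ U , p , z ⟩ cs = consistent-stride U p z cs (neg-odd 1-odd)
  consistent-move green ⟨ V , p , z ⟩ cs = consistent-stride V p z cs a-odd

  vertex : Pos → Vertex n
  vertex s = (side s , reduce (coord s))

  lift : Vertex n → Pos
  lift (S , i) = ⟨ S , isOdd (toℕ i) , + toℕ i ⟩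

  nbr : Colour → Vertex n → Vertex n
  nbr c x = vertex (move c (lift x))

  infix 4 _∼_
  _∼_ : Pos → Pos → Set
  s ∼ t = side s ≡ side t × odd s ≡ odd t × coord s ≋ coord t

  move-cong : ∀ c {s t} → s ∼ t → move c s ∼ move c t
  move-cong red {⟨ S , p , z ⟩} {⟨ .S , .p , w ⟩} (refl , refl , z≋w) = refl , refl , z≋w
  move-cong blue {⟨ S , p , z ⟩} {⟨ .S , .p , w ⟩} (refl , refl , z≋w) = refl , refl , ≋-+ z≋w ≋-refl
  move-cong green {⟨ S , p , z ⟩} {⟨ .S , .p , w ⟩} (refl , refl , z≋w) = refl , refl , ≋-+ z≋w ≋-refl

  vertex-cong : ∀ {s t} → s ∼ t → vertex s ≡ vertex t
  vertex-cong (S≡ , _ , z≋w) = cong₂ _,_ S≡ (reduce-cong z≋w)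

  vertex-≋ : ∀ (S : Side) {z w} → z ≋ w → (S , reduce z) ≡ (S , reduce w)
  vertex-≋ S z≋w = cong (S ,_) (reduce-cong z≋w)

  vertex-injective : ∀ s t → vertex s ≡ vertex t → side s ≡ side t × coord s ≋ coord t
  vertex-injective s t eq = cong proj₁ eq , reduce-injective (cong proj₂ eq)

  private
    telescope : ∀ t z → z + (t - z) ≡ t
    telescope = solve-∀

  vertex-toℕ : ∀ S p (i : Fin n) → vertex ⟨ S , p , + toℕ i ⟩ ≡ (S , i)
  vertex-toℕ S p i = cong (S ,_) (reduce-toℕ i)

  reduce-shift-even : ∀ z → Evenℤ (+ toℕ (reduce z) - z)
  reduce-shift-even z = ℤ∣.∣-trans n-even (_≋_.n∣x-y (toℕ-reduce-≋ z))

  reduce-preserves-even : ∀ {z} → Evenℤ z → Evenℤ (+ toℕ (reduce z))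
  reduce-preserves-even {z} ez = subst Evenℤ (telescope (+ toℕ (reduce z)) z) (even+even ez (reduce-shift-even z))

  reduce-preserves-odd : ∀ {z} → Oddℤ z → Oddℤ (+ toℕ (reduce z))
  reduce-preserves-odd {z} oz = subst Oddℤ (telescope (+ toℕ (reduce z)) z) (odd+even oz (reduce-shift-even z))

  lift-vertex : ∀ s → Consistent s → lift (vertex s) ∼ s
  lift-vertex ⟨ S , false , z ⟩ ez =
    refl , cong (ℕ._≡ᵇ 1) (even⇒%2≡0 (reduce-preserves-even ez)) , toℕ-reduce-≋ z
  lift-vertex ⟨ S , true , z ⟩ oz =
    refl , cong (ℕ._≡ᵇ 1) (odd⇒%2≡1 (reduce-preserves-odd oz)) , toℕ-reduce-≋ z

  nbr-vertex : ∀ c s → Consistent s → nbr c (vertex s) ≡ vertex (move c s)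
  nbr-vertex c s cs = vertex-cong (move-cong c (lift-vertex s cs))

  lift-even : ∀ S (i : Fin n) → toℕ i ℕ.% 2 ≡ 0 → lift (S , i) ≡ ⟨ S , false , + toℕ i ⟩
  lift-even S i i%2≡0 = cong (λ p → ⟨ S , p , + toℕ i ⟩) (cong (ℕ._≡ᵇ 1) i%2≡0)

  lift-odd : ∀ S (i : Fin n) → toℕ i ℕ.% 2 ≡ 1 → lift (S , i) ≡ ⟨ S , true , + toℕ i ⟩
  lift-odd S i i%2≡1 = cong (λ p → ⟨ S , p , + toℕ i ⟩) (cong (ℕ._≡ᵇ 1) i%2≡1)

  consistent-lift : ∀ x → Consistent (lift x)
  consistent-lift (S , i) with %2≡0⊎%2≡1 (toℕ i)
  ... | inj₁ i%2≡0 = subst Consistent (sym (lift-even S i i%2≡0)) (%2≡0⇒even (toℕ i) i%2≡0)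
  ... | inj₂ i%2≡1 = subst Consistent (sym (lift-odd S i i%2≡1)) (%2≡1⇒odd (toℕ i) i%2≡1)

  vertex-lift : ∀ x → vertex (lift x) ≡ x
  vertex-lift (S , i) = cong (S ,_) (reduce-toℕ i)

  walk : List Colour → Vertex n → Vertex n
  walk [] x = x
  walk (c ∷ w) x = walk w (nbr c x)

  walkPos : List Colour → Pos → Pos
  walkPos [] s = s
  walkPos (c ∷ w) s = walkPos w (move c s)

  consistent-walkPos : ∀ w s → Consistent s → Consistent (walkPos w s)
  consistent-walkPos [] s cs = cs
  consistent-walkPos (c ∷ w) s cs = consistent-walkPos w (move c s) (consistent-move c s cs)

  walk-vertex : ∀ w s → Consistent s → walk w (vertex s) ≡ vertex (walkPos w s)
  walk-vertex [] s cs = refl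
  walk-vertex (c ∷ w) s cs =
    trans (cong (walk w) (nbr-vertex c s cs)) (walk-vertex w (move c s) (consistent-move c s cs))

  ⊕-vertex : ∀ S p (i : Fin n) k → (S , i ⊕ k) ≡ vertex ⟨ S , p , + toℕ i + + k ⟩
  ⊕-vertex S p i k = cong (S ,_) (Finₚ.toℕ-injective
    (trans (Finₚ.toℕ-fromℕ< _) (sym (toℕ-reduce (+ (toℕ i ℕ.+ k))))))

module Colouring (n a b : ℕ) .{{_ : NonZero n}} (n-even : Evenℤ (+ n))
                 (a-odd : Oddℤ (+ a)) (b-odd : Oddℤ (+ b))
                 (y≡a : yPar n a b ≡ a) (x≡b : xPar n a b ≡ b) where

  open Cover n a b n-even a-odd b-odd public
  open MO n a b

  Class : Colour → Vertex n → Vertex n → Set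
  Class red = Rset
  Class blue = Bset
  Class green = Gset

  step-forward : ∀ c S p (i : Fin n) k → lift (S , i) ≡ ⟨ S , p , + toℕ i ⟩ →
                 move c ⟨ S , p , + toℕ i ⟩ ≡ ⟨ S , not p , + toℕ i + + k ⟩ → nbr c (S , i) ≡ (S , i ⊕ k)
  step-forward c S p i k lift≡ move≡ =
    trans (cong (λ s → vertex (move c s)) lift≡) (trans (cong vertex move≡) (sym (⊕-vertex S (not p) i k)))

  step-back : ∀ c S p (i : Fin n) k → Consistent ⟨ S , p , + toℕ i + + k ⟩ →
              move c ⟨ S , p , + toℕ i + + k ⟩ ≡ ⟨ S , not p , + toℕ i + + k - + k ⟩ →
              nbr c (S , i ⊕ k) ≡ (S , i)
  step-back c S p i k cs move≡ = begin
    nbr c (S , i ⊕ k)                                ≡⟨ cong (nbr c) (⊕-vertex S p i k) ⟩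
    nbr c (vertex ⟨ S , p , + toℕ i + + k ⟩)         ≡⟨ nbr-vertex c _ cs ⟩
    vertex (move c ⟨ S , p , + toℕ i + + k ⟩)        ≡⟨ cong vertex move≡ ⟩
    vertex ⟨ S , not p , + toℕ i + + k - + k ⟩       ≡⟨ vertex-≋ S (≋-reflexive (cancel (+ toℕ i) (+ k))) ⟩
    vertex ⟨ S , not p , + toℕ i ⟩                   ≡⟨ vertex-toℕ S (not p) i ⟩
    (S , i)                                          ∎
    where
    open ≡-Reasoning
    cancel : ∀ x k → x + k - k ≡ x
    cancel = solve-∀

  ⊕-undo : ∀ S (i : Fin n) k → (S , reduce (+ toℕ i - + k) ⊕ k) ≡ (S , i)
  ⊕-undo S i k = begin
    (S , reduce (+ toℕ i - + k) ⊕ k)                        ≡⟨ ⊕-vertex S false _ k ⟩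
    vertex ⟨ S , false , + toℕ (reduce (+ toℕ i - + k)) + + k ⟩ ≡⟨ vertex-≋ S (≋-+ (toℕ-reduce-≋ (+ toℕ i - + k)) (≋-refl {+ k})) ⟩
    vertex ⟨ S , false , + toℕ i - + k + + k ⟩                ≡⟨ vertex-≋ S (≋-reflexive (cancel (+ toℕ i) (+ k))) ⟩
    vertex ⟨ S , false , + toℕ i ⟩                           ≡⟨ vertex-toℕ S false i ⟩
    (S , i)                                                 ∎
    where
    open ≡-Reasoning
    cancel : ∀ x k → x - k + k ≡ x
    cancel = solve-∀

  %2-back-even : ∀ (i : Fin n) k → toℕ i ℕ.% 2 ≡ 1 → Oddℤ (+ k) → toℕ (reduce (+ toℕ i - + k)) ℕ.% 2 ≡ 0
  %2-back-even i k i-odd k-odd = even⇒%2≡0 (reduce-preserves-even (odd+odd (%2≡1⇒odd (toℕ i) i-odd) (neg-odd k-odd)))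

  %2-back-odd : ∀ (i : Fin n) k → toℕ i ℕ.% 2 ≡ 0 → Oddℤ (+ k) → toℕ (reduce (+ toℕ i - + k)) ℕ.% 2 ≡ 1
  %2-back-odd i k i-even k-odd = odd⇒%2≡1 (reduce-preserves-odd (even+odd (%2≡0⇒even (toℕ i) i-even) (neg-odd k-odd)))

  Rset⇒red : ∀ {x y} → Rset x y → y ≡ nbr red x
  Rset⇒red (inj₁ (i , refl , refl)) = sym (vertex-toℕ V false i)
  Rset⇒red (inj₂ (i , refl , refl)) = sym (vertex-toℕ U false i)

  red-Rset : ∀ x → Rset x (nbr red x)
  red-Rset (U , i) = inj₁ (i , refl , vertex-toℕ V false i)
  red-Rset (V , i) = inj₂ (i , vertex-toℕ U false i , refl)

  Gset⇒green : ∀ {x y} → Gset x y → y ≡ nbr green x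
  Gset⇒green (inj₁ (inj₁ (i , i-odd , refl , refl))) =
    sym (step-forward green U true i 1 (lift-odd U i i-odd) refl)
  Gset⇒green (inj₁ (inj₂ (j , j-even , refl , refl))) rewrite y≡a =
    sym (step-forward green V false j a (lift-even V j j-even) refl)
  Gset⇒green (inj₂ (inj₁ (i , i-odd , refl , refl))) =
    sym (step-back green U false i 1 (odd+odd (%2≡1⇒odd (toℕ i) i-odd) 1-odd) refl)
  Gset⇒green (inj₂ (inj₂ (j , j-even , refl , refl))) rewrite y≡a =
    sym (step-back green V true j a (even+odd (%2≡0⇒even (toℕ j) j-even) a-odd) refl)

  green-Gset : ∀ x → Gset x (nbr green x)
  green-Gset (U , i) with %2≡0⊎%2≡1 (toℕ i)
  ... | inj₁ i-even = inj₂ (inj₁ (reduce (+ toℕ i - + 1) , %2-back-odd i 1 i-even 1-odd ,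
                                  cong (λ s → vertex (move green s)) (lift-even U i i-even) , sym (⊕-undo U i 1)))
  ... | inj₂ i-odd = inj₁ (inj₁ (i , i-odd , refl , step-forward green U true i 1 (lift-odd U i i-odd) refl))
  green-Gset (V , j) with %2≡0⊎%2≡1 (toℕ j)
  ... | inj₁ j-even = inj₁ (inj₂ (j , j-even , refl ,
                        trans (step-forward green V false j a (lift-even V j j-even) refl) (cong (λ k → (V , j ⊕ k)) (sym y≡a))))
  ... | inj₂ j-odd = inj₂ (inj₂ (reduce (+ toℕ j - + a) , %2-back-even j a j-odd a-odd ,
                                 cong (λ s → vertex (move green s)) (lift-odd V j j-odd) ,
                                 trans (sym (⊕-undo V j a)) (cong (λ k → (V , reduce (+ toℕ j - + a) ⊕ k)) (sym y≡a))))

  Bset⇒blue : ∀ {x y} → Bset x y → y ≡ nbr blue x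
  Bset⇒blue (inj₁ (inj₁ (i , i-even , refl , refl))) =
    sym (step-forward blue U false i 1 (lift-even U i i-even) refl)
  Bset⇒blue (inj₁ (inj₂ (j , j-even , refl , refl))) rewrite x≡b =
    sym (step-forward blue V false j b (lift-even V j j-even) refl)
  Bset⇒blue (inj₂ (inj₁ (i , i-even , refl , refl))) =
    sym (step-back blue U true i 1 (even+odd (%2≡0⇒even (toℕ i) i-even) 1-odd) refl)
  Bset⇒blue (inj₂ (inj₂ (j , j-even , refl , refl))) rewrite x≡b =
    sym (step-back blue V true j b (even+odd (%2≡0⇒even (toℕ j) j-even) b-odd) refl)

  blue-Bset : ∀ x → Bset x (nbr blue x)
  blue-Bset (U , i) with %2≡0⊎%2≡1 (toℕ i)
  ... | inj₁ i-even = inj₁ (inj₁ (i , i-even , refl , step-forward blue U false i 1 (lift-even U i i-even) refl))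
  ... | inj₂ i-odd = inj₂ (inj₁ (reduce (+ toℕ i - + 1) , %2-back-even i 1 i-odd 1-odd ,
                                 cong (λ s → vertex (move blue s)) (lift-odd U i i-odd) , sym (⊕-undo U i 1)))
  blue-Bset (V , j) with %2≡0⊎%2≡1 (toℕ j)
  ... | inj₁ j-even = inj₁ (inj₂ (j , j-even , refl ,
                        trans (step-forward blue V false j b (lift-even V j j-even) refl) (cong (λ k → (V , j ⊕ k)) (sym x≡b))))
  ... | inj₂ j-odd = inj₂ (inj₂ (reduce (+ toℕ j - + b) , %2-back-even j b j-odd b-odd ,
                                 cong (λ s → vertex (move blue s)) (lift-odd V j j-odd) ,
                                 trans (sym (⊕-undo V j b)) (cong (λ k → (V , reduce (+ toℕ j - + b) ⊕ k)) (sym x≡b))))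

  class⇒nbr : ∀ c {x y} → Class c x y → y ≡ nbr c x
  class⇒nbr red = Rset⇒red
  class⇒nbr blue = Bset⇒blue
  class⇒nbr green = Gset⇒green

  nbr-class : ∀ c x → Class c x (nbr c x)
  nbr-class red = red-Rset
  nbr-class blue = blue-Bset
  nbr-class green = green-Gset

  class⇔nbr : ∀ c {x y} → Class c x y ⇔ y ≡ nbr c x
  class⇔nbr c {x} = mk⇔ (class⇒nbr c) (λ { refl → nbr-class c x })

  Edge : Vertex n → Vertex n → Set
  Edge x y = RimD (λ _ → ⊤) x y ⊎ SpokeD x y ⊎ InnerD a x y ⊎ InnerD b x y

  class-sym : ∀ c {x y} → Class c x y → Class c y x
  class-sym red = ⊎-swap
  class-sym blue = ⊎-swap
  class-sym green = ⊎-swap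

  edge⇒class : ∀ {x y} → Edge x y → ∃ λ c → Class c x y
  edge⇒class (inj₁ (i , _ , x≡ , y≡)) with %2≡0⊎%2≡1 (toℕ i)
  ... | inj₁ i-even = blue , inj₁ (inj₁ (i , i-even , x≡ , y≡))
  ... | inj₂ i-odd = green , inj₁ (inj₁ (i , i-odd , x≡ , y≡))
  edge⇒class (inj₂ (inj₁ spoke)) = red , inj₁ spoke
  edge⇒class (inj₂ (inj₂ (inj₁ (j , j-even , x≡ , y≡)))) =
    green , inj₁ (inj₂ (j , j-even , x≡ , trans y≡ (cong (λ k → (V , j ⊕ k)) (sym y≡a))))
  edge⇒class (inj₂ (inj₂ (inj₂ (j , j-even , x≡ , y≡)))) =
    blue , inj₁ (inj₂ (j , j-even , x≡ , trans y≡ (cong (λ k → (V , j ⊕ k)) (sym x≡b))))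

  Adj⇒class : ∀ {x y} → Adj x y → ∃ λ c → Class c x y
  Adj⇒class (inj₁ e) = edge⇒class e
  Adj⇒class (inj₂ e) with edge⇒class e
  ... | c , k = c , class-sym c k

  class⇒Adj : ∀ c {x y} → Class c x y → Adj x y
  class⇒Adj red = ⊎-map (λ spoke → inj₂ (inj₁ spoke)) (λ spoke → inj₂ (inj₁ spoke))
  class⇒Adj blue = ⊎-map blue-edge blue-edge
    where
    blue-edge : ∀ {x y} → RimD Even x y ⊎ InnerD (xPar n a b) x y → Edge x y
    blue-edge (inj₁ (i , _ , x≡ , y≡)) = inj₁ (i , tt , x≡ , y≡)
    blue-edge (inj₂ (j , j-even , x≡ , y≡)) =
      inj₂ (inj₂ (inj₂ (j , j-even , x≡ , trans y≡ (cong (λ k → (V , j ⊕ k)) x≡b))))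
  class⇒Adj green = ⊎-map green-edge green-edge
    where
    green-edge : ∀ {x y} → RimD Odd x y ⊎ InnerD (yPar n a b) x y → Edge x y
    green-edge (inj₁ (i , _ , x≡ , y≡)) = inj₁ (i , tt , x≡ , y≡)
    green-edge (inj₂ (j , j-even , x≡ , y≡)) =
      inj₂ (inj₂ (inj₁ (j , j-even , x≡ , trans y≡ (cong (λ k → (V , j ⊕ k)) y≡a))))

  Adj⇔nbr : ∀ {x y} → Adj x y ⇔ (∃ λ c → y ≡ nbr c x)
  Adj⇔nbr = mk⇔ (λ adj → let (c , k) = Adj⇒class adj in c , class⇒nbr c k)
                (λ { (c , refl) → class⇒Adj c (nbr-class c _) })

module Necessity (n a b : ℕ) .{{_ : NonZero n}}
                 (n%2≡0 : n ℕ.% 2 ≡ 0) (a%2≡1 : a ℕ.% 2 ≡ 1) (b%2≡1 : b ℕ.% 2 ≡ 1)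
                 (y≡a : yPar n a b ≡ a) (x≡b : xPar n a b ≡ b)
                 (2<n : 2 ℕ.< n) (a<b : a ℕ.< b) (b<n : b ℕ.< n)
                 (φ : MO.Automorphism n a b)
                 (G↦R : MO.MapsOnto n a b φ (MO.Gset n a b) (MO.Rset n a b))
                 (R↦G : MO.MapsOnto n a b φ (MO.Rset n a b) (MO.Gset n a b)) where

  open MO.Automorphism φ using (f; f⁻¹; left; adj)

  f-injective : ∀ {x y} → f x ≡ f y → x ≡ y
  f-injective {x} {y} fx≡fy = trans (sym (left x)) (trans (cong f⁻¹ fx≡fy) (left y))

  open Colouring n a b (%2≡0⇒even n n%2≡0) (%2≡1⇒odd a a%2≡1) (%2≡1⇒odd b b%2≡1) y≡a x≡b

  blue≢green : ∀ x → nbr blue x ≢ nbr green x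
  blue≢green x eq =
    strides-differ (lift x) (≋-cancelˡ {coord (lift x)} (proj₂ (vertex-injective (move blue (lift x)) (move green (lift x)) eq)))
    where
    +1≉-1 : + 1 ≋ - + 1 → ⊥
    +1≉-1 1≋-1 with ≋-<⇒≡ 2<n (ℕₚ.<-trans (s≤s z≤n) 2<n) (≋-+ 1≋-1 (≋-refl {+ 1}))
    ... | ()
    strides-differ : ∀ s → signed (odd s) (blueStride (side s)) ≋ signed (odd s) (greenStride (side s)) → ⊥
    strides-differ ⟨ U , false , _ ⟩ e = +1≉-1 e
    strides-differ ⟨ U , true , _ ⟩ e = +1≉-1 (≋-sym e)
    strides-differ ⟨ V , false , _ ⟩ e = ℕₚ.<⇒≢ a<b (sym (≋-<⇒≡ b<n (ℕₚ.<-trans a<b b<n) e))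
    strides-differ ⟨ V , true , _ ⟩ e = ℕₚ.<⇒≢ a<b (sym (≋-<⇒≡ b<n (ℕₚ.<-trans a<b b<n) (≋-neg e)))

  f-red : ∀ x → f (nbr red x) ≡ nbr green (f x)
  f-red x = Gset⇒green (Equivalence.to (R↦G x (nbr red x)) (red-Rset x))

  f-green : ∀ x → f (nbr green x) ≡ nbr red (f x)
  f-green x = Rset⇒red (Equivalence.to (G↦R x (nbr green x)) (green-Gset x))

  -- f maps a blue edge to an edge that is neither red = f(green) nor green = f(red).
  f-blue : ∀ x → f (nbr blue x) ≡ nbr blue (f x)
  f-blue x with Equivalence.to Adj⇔nbr (Equivalence.to (adj x (nbr blue x)) (class⇒Adj blue (blue-Bset x)))
  ... | red , e = ⊥-elim (blue≢green x (f-injective (trans e (sym (f-green x)))))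
  ... | blue , e = e
  ... | green , e = ⊥-elim (flip≢ (proj₁ x) (sym (cong proj₁ (f-injective (trans e (sym (f-red x)))))))

  f-nbr : ∀ c x → f (nbr c x) ≡ nbr (swap c) (f x)
  f-nbr red = f-red
  f-nbr blue = f-blue
  f-nbr green = f-green

  f-walk : ∀ w x → f (walk w x) ≡ walk (map swap w) (f x)
  f-walk [] x = refl
  f-walk (c ∷ w) x = trans (f-walk w (nbr c x)) (cong (walk (map swap w)) (f-nbr c x))

  -- In the image of f the four rim steps from u₄ₖ to u₄ₖ₊₄ become the walk blue-red-blue-red,
  -- which in the cover is a translation by ±σ.
  translate : ℕ → Pos → Pos
  translate k ⟨ S , p , z ⟩ = ⟨ S , p , z + signed (p xor isV S) (+ k * σ) ⟩

  consistent-translate : ∀ k s → Consistent s → Consistent (translate k s)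
  consistent-translate k ⟨ S , false , z ⟩ cs = even+even cs (signed-even (isV S) (ℤ∣.∣n⇒∣m*n (+ k) σ-even))
  consistent-translate k ⟨ S , true , z ⟩ cs = odd+even cs (signed-even (not (isV S)) (ℤ∣.∣n⇒∣m*n (+ k) σ-even))

  translate-zero : ∀ s → coord (translate 0 s) ≡ coord s
  translate-zero ⟨ S , p , z ⟩ = trans (cong (λ u → z + u) (signed-zero (p xor isV S))) (ℤₚ.+-identityʳ z)

  rim4 : List Colour
  rim4 = blue ∷ green ∷ blue ∷ green ∷ []

  translate-suc : ∀ k s → vertex (walkPos (map swap rim4) (translate k s)) ≡ vertex (translate (suc k) s)
  translate-suc k ⟨ U , false , z ⟩ = vertex-≋ U (≋-reflexive (shift z (+ k) (+ b)))
    where shift : ∀ z k b → z + k * (+ 1 - b) + + 1 + - b ≡ z + (+ 1 + k) * (+ 1 - b)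
          shift = solve-∀
  translate-suc k ⟨ U , true , z ⟩ = vertex-≋ U (≋-reflexive (shift z (+ k) (+ b)))
    where shift : ∀ z k b → z - k * (+ 1 - b) - + 1 + b ≡ z - (+ 1 + k) * (+ 1 - b)
          shift = solve-∀
  translate-suc k ⟨ V , false , z ⟩ = vertex-≋ V (≋-reflexive (shift z (+ k) (+ b)))
    where shift : ∀ z k b → z - k * (+ 1 - b) + b - + 1 ≡ z - (+ 1 + k) * (+ 1 - b)
          shift = solve-∀
  translate-suc k ⟨ V , true , z ⟩ = vertex-≋ V (≋-reflexive (shift z (+ k) (+ b)))
    where shift : ∀ z k b → z + k * (+ 1 - b) - b + + 1 ≡ z + (+ 1 + k) * (+ 1 - b)
          shift = solve-∀

  start : ℕ → Pos
  start k = ⟨ U , false , + k * + 4 ⟩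

  consistent-start : ∀ k → Consistent (start k)
  consistent-start k = divides (+ k * + 2) (double (+ k))
    where double : ∀ k → k * + 4 ≡ k * + 2 * + 2
          double = solve-∀

  u₄ : ℕ → Vertex n
  u₄ k = vertex (start k)

  u₄-suc : ∀ k → u₄ (suc k) ≡ walk rim4 (u₄ k)
  u₄-suc k = sym (trans (walk-vertex rim4 (start k) (consistent-start k)) (vertex-≋ U (≋-reflexive (shift (+ k)))))
    where shift : ∀ k → k * + 4 + + 1 + + 1 + + 1 + + 1 ≡ (+ 1 + k) * + 4
          shift = solve-∀

  s₀ : Pos
  s₀ = lift (f (u₄ 0))

  f-u₄ : ∀ k → f (u₄ k) ≡ vertex (translate k s₀)
  f-u₄ zero = trans (sym (vertex-lift (f (u₄ 0)))) (vertex-≋ (side s₀) (≋-reflexive (sym (translate-zero s₀))))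
  f-u₄ (suc k) = begin
    f (u₄ (suc k))                                         ≡⟨ cong f (u₄-suc k) ⟩
    f (walk rim4 (u₄ k))                                   ≡⟨ f-walk rim4 (u₄ k) ⟩
    walk (map swap rim4) (f (u₄ k))                        ≡⟨ cong (walk (map swap rim4)) (f-u₄ k) ⟩
    walk (map swap rim4) (vertex (translate k s₀))         ≡⟨ walk-vertex (map swap rim4) _ (consistent-translate k s₀ (consistent-lift _)) ⟩
    vertex (walkPos (map swap rim4) (translate k s₀))      ≡⟨ translate-suc k s₀ ⟩
    vertex (translate (suc k) s₀)                          ∎
    where open ≡-Reasoning

  image : ℕ → List Colour → Pos → Pos
  image k w s = walkPos (map swap w) (translate k s)

  transfer : ∀ k₁ k₂ w₁ w₂ → walkPos w₁ (start k₁) ∼ walkPos w₂ (start k₂) →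
             side (image k₁ w₁ s₀) ≡ side (image k₂ w₂ s₀) × coord (image k₁ w₁ s₀) ≋ coord (image k₂ w₂ s₀)
  transfer k₁ k₂ w₁ w₂ start∼start =
    vertex-injective (walkPos (map swap w₁) (translate k₁ s₀)) (walkPos (map swap w₂) (translate k₂ s₀)) (begin
    vertex (walkPos (map swap w₁) (translate k₁ s₀)) ≡⟨ sym (walk-vertex (map swap w₁) _ (consistent-translate k₁ s₀ (consistent-lift _))) ⟩
    walk (map swap w₁) (vertex (translate k₁ s₀))     ≡⟨ cong (walk (map swap w₁)) (sym (f-u₄ k₁)) ⟩
    walk (map swap w₁) (f (u₄ k₁))                    ≡⟨ sym (f-walk w₁ (u₄ k₁)) ⟩
    f (walk w₁ (u₄ k₁))                               ≡⟨ cong f walks-meet ⟩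
    f (walk w₂ (u₄ k₂))                               ≡⟨ f-walk w₂ (u₄ k₂) ⟩
    walk (map swap w₂) (f (u₄ k₂))                    ≡⟨ cong (walk (map swap w₂)) (f-u₄ k₂) ⟩
    walk (map swap w₂) (vertex (translate k₂ s₀))     ≡⟨ walk-vertex (map swap w₂) _ (consistent-translate k₂ s₀ (consistent-lift _)) ⟩
    vertex (walkPos (map swap w₂) (translate k₂ s₀)) ∎)
    where
    open ≡-Reasoning
    walks-meet : walk w₁ (u₄ k₁) ≡ walk w₂ (u₄ k₂)
    walks-meet = trans (walk-vertex w₁ (start k₁) (consistent-start k₁))
                   (trans (vertex-cong start∼start) (sym (walk-vertex w₂ (start k₂) (consistent-start k₂))))

  half : ℕ
  half = n ℕ./ 2

  +n≡half*2 : + n ≡ + half * + 2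
  +n≡half*2 = trans (+-%-/ n 2) (trans (cong (λ r → + r + + half * + 2) n%2≡0) (ℤₚ.+-identityˡ _))

  -- If n ≡ 2 (mod 4), two rim steps from u_{n-2} reach u₀; the image walk blue-red changes side.
  half-even : half ℕ.% 2 ≡ 0
  half-even with %2≡0⊎%2≡1 half
  ... | inj₁ half%2≡0 = half%2≡0
  ... | inj₂ half%2≡1 = ⊥-elim (flip≢ (side s₀) (proj₁
        (transfer (half ℕ./ 2) 0 (blue ∷ green ∷ []) [] (refl , refl , ≋-from-∣ (divides (+ 1) wrap)))))
    where
    open ≡-Reasoning
    regroup : ∀ q → q * + 4 + + 1 + + 1 - + 0 * + 4 ≡ + 1 * ((+ 1 + q * + 2) * + 2)
    regroup = solve-∀
    wrap : + (half ℕ./ 2) * + 4 + + 1 + + 1 - + 0 * + 4 ≡ + 1 * + n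
    wrap = begin
      + (half ℕ./ 2) * + 4 + + 1 + + 1 - + 0 * + 4 ≡⟨ regroup (+ (half ℕ./ 2)) ⟩
      + 1 * ((+ 1 + + (half ℕ./ 2) * + 2) * + 2)   ≡⟨ cong (λ r → + 1 * ((+ r + + (half ℕ./ 2) * + 2) * + 2)) (sym half%2≡1) ⟩
      + 1 * ((+ (half ℕ.% 2) + + (half ℕ./ 2) * + 2) * + 2) ≡⟨ cong (λ h → + 1 * (h * + 2)) (sym (+-%-/ half 2)) ⟩
      + 1 * (+ half * + 2)                         ≡⟨ cong (λ u → + 1 * u) (sym +n≡half*2) ⟩
      + 1 * + n                                    ∎

  m : ℕ
  m = half ℕ./ 2

  +n≡m*4 : + n ≡ + m * + 4
  +n≡m*4 = trans +n≡half*2 (trans (cong (_* + 2) +half≡m*2) (double (+ m)))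
    where
    +half≡m*2 : + half ≡ + m * + 2
    +half≡m*2 = trans (+-%-/ half 2) (trans (cong (λ r → + r + + m * + 2) half-even) (ℤₚ.+-identityˡ _))
    double : ∀ m → m * + 2 * + 2 ≡ m * + 4
    double = solve-∀

  m≢0 : m ≢ 0
  m≢0 m≡0 = ℕₚ.<⇒≢ (ℕₚ.<-trans (s≤s z≤n) 2<n) (sym (ℤₚ.+-injective (trans +n≡m*4 (cong (λ k → + k * + 4) m≡0))))

  -- u₄ₘ = u₀, and the image of this loop is a translation by ±mσ.
  n∣mσ : + n ∣ᶻ + m * σ
  n∣mσ = ≋0⇒∣ (signed-cancel (odd s₀ xor isV (side s₀))
                 (≋-cancelˡ {coord s₀} (proj₂ (transfer m 0 [] [] (refl , refl , ≋-from-∣ (divides (+ 1) wrap))))))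
    where
    regroup : ∀ m → m * + 4 - + 0 * + 4 ≡ + 1 * (m * + 4)
    regroup = solve-∀
    wrap : + m * + 4 - + 0 * + 4 ≡ + 1 * + n
    wrap = trans (regroup (+ m)) (cong (λ u → + 1 * u) (sym +n≡m*4))

  4∣σ : + 4 ∣ᶻ σ
  4∣σ = ℤ∣.*-cancelˡ-∣ (+ m) {{ℕ.≢-nonZero m≢0}} (subst (_∣ᶻ + m * σ) +n≡m*4 n∣mσ)

  b%4≡1 : b ℕ.% 4 ≡ 1
  b%4≡1 = %-unique (- ℤ∣.quotient 4∣σ) (s≤s (s≤s z≤n)) (begin
    + b                            ≡⟨ complement (+ b) ⟩
    + 1 - σ                        ≡⟨ cong (λ u → + 1 - u) (ℤ∣._∣_.equality 4∣σ) ⟩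
    + 1 - ℤ∣.quotient 4∣σ * + 4     ≡⟨ cong (λ u → + 1 + u) (ℤₚ.neg-distribˡ-* (ℤ∣.quotient 4∣σ) (+ 4)) ⟩
    + 1 + - ℤ∣.quotient 4∣σ * + 4   ∎)
    where
    open ≡-Reasoning
    complement : ∀ b → b ≡ + 1 - (+ 1 - b)
    complement = solve-∀

  -- If a ≡ 1 (mod 4), v_a is reached from u_{a-1} by blue-red and from u₀ by red-green;
  -- the images are blue-green and green-red, which end on different sides.
  a%4≢1 : a ℕ.% 4 ≢ 1
  a%4≢1 a%4≡1 = flip≢ (side s₀) (sym (proj₁
    (transfer (a ℕ./ 4) 0 (blue ∷ red ∷ []) (red ∷ green ∷ []) (refl , refl , ≋-reflexive v_a))))
    where
    v_a : + (a ℕ./ 4) * + 4 + + 1 ≡ + 0 * + 4 + + a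
    v_a = trans (ℤₚ.+-comm (+ (a ℕ./ 4) * + 4) (+ 1)) (trans (cong (λ r → + r + + (a ℕ./ 4) * + 4) (sym a%4≡1))
            (trans (sym (+-%-/ a 4)) (sym (ℤₚ.+-identityˡ (+ a)))))

  a%4≡3 : a ℕ.% 4 ≡ 3
  a%4≡3 = [ ⊥-elim ∘ a%4≢1 , (λ a%4≡3 → a%4≡3) ]′ (odd⇒%4≡1⊎%4≡3 a a%2≡1)

  b₀ a₀ : ℕ
  b₀ = b ℕ./ 4
  a₀ = a ℕ./ 4

  +b≡ : + b ≡ + 1 + + b₀ * + 4
  +b≡ = trans (+-%-/ b 4) (cong (λ r → + r + + b₀ * + 4) b%4≡1)

  +a≡ : + a ≡ + 3 + + a₀ * + 4
  +a≡ = trans (+-%-/ a 4) (cong (λ r → + r + + a₀ * + 4) a%4≡3)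

  P₁ P₂ P₃ : ℤ
  P₁ = + b₀ * σ + + 4
  P₂ = + b₀ * σ - + 2 * + b + + 2 * + a
  P₃ = + a₀ * σ + + 2 - + b + + a

  congruences : ∀ s →
    coord (image b₀ (blue ∷ red ∷ []) s) ≋ coord (image 0 (red ∷ blue ∷ []) s) →
    coord (image a₀ (blue ∷ green ∷ blue ∷ red ∷ []) s) ≋ coord (image 0 (red ∷ green ∷ []) s) →
    coord (image b₀ (blue ∷ green ∷ blue ∷ red ∷ []) s) ≋ coord (image 0 (blue ∷ green ∷ red ∷ blue ∷ []) s) →
    + n ∣ᶻ P₁ × + n ∣ᶻ P₂ × + n ∣ᶻ P₃
  congruences ⟨ U , false , z ⟩ e₁ e₂ e₃ =
    difference-∣ false e₁ (h₁ z (+ b₀) σ) , difference-∣ false e₃ (h₂ z (+ b₀) σ (+ a) (+ b)) ,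
    difference-∣ false e₂ (h₃ z (+ a₀) σ (+ a) (+ b))
    where
    h₁ : ∀ z k s → (z + k * s + + 1 + + 1) - (z + + 0 * s - + 1 - + 1) ≡ k * s + + 4
    h₁ = solve-∀
    h₂ : ∀ z k s a b → (z + k * s + + 1 - b + a) - (z + + 0 * s + + 1 - a + b) ≡ k * s - + 2 * b + + 2 * a
    h₂ = solve-∀
    h₃ : ∀ z k s a b → (z + k * s + + 1 - b + a) - (z + + 0 * s - + 1) ≡ k * s + + 2 - b + a
    h₃ = solve-∀
  congruences ⟨ U , true , z ⟩ e₁ e₂ e₃ =
    difference-∣ true e₁ (h₁ z (+ b₀) σ) , difference-∣ true e₃ (h₂ z (+ b₀) σ (+ a) (+ b)) ,
    difference-∣ true e₂ (h₃ z (+ a₀) σ (+ a) (+ b))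
    where
    h₁ : ∀ z k s → (z - k * s - + 1 - + 1) - (z - + 0 * s + + 1 + + 1) ≡ - (k * s + + 4)
    h₁ = solve-∀
    h₂ : ∀ z k s a b → (z - k * s - + 1 + b - a) - (z - + 0 * s - + 1 + a - b) ≡ - (k * s - + 2 * b + + 2 * a)
    h₂ = solve-∀
    h₃ : ∀ z k s a b → (z - k * s - + 1 + b - a) - (z - + 0 * s + + 1) ≡ - (k * s + + 2 - b + a)
    h₃ = solve-∀
  congruences ⟨ V , false , z ⟩ e₁ e₂ e₃ =
    difference-∣ true e₃ (h₁ z (+ b₀) σ (+ b)) , difference-∣ true e₁ (h₂ z (+ b₀) σ (+ a) (+ b)) ,
    difference-∣ true e₂ (h₃ z (+ a₀) σ (+ a) (+ b))
    where
    h₁ : ∀ z k s b → (z - k * s + b - + 1 - + 1) - (z - + 0 * s + b + + 1 + + 1) ≡ - (k * s + + 4)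
    h₁ = solve-∀
    h₂ : ∀ z k s a b → (z - k * s + b - a) - (z - + 0 * s + a - b) ≡ - (k * s - + 2 * b + + 2 * a)
    h₂ = solve-∀
    h₃ : ∀ z k s a b → (z - k * s + b - + 1 - + 1) - (z - + 0 * s + a) ≡ - (k * s + + 2 - b + a)
    h₃ = solve-∀
  congruences ⟨ V , true , z ⟩ e₁ e₂ e₃ =
    difference-∣ false e₃ (h₁ z (+ b₀) σ (+ b)) , difference-∣ false e₁ (h₂ z (+ b₀) σ (+ a) (+ b)) ,
    difference-∣ false e₂ (h₃ z (+ a₀) σ (+ a) (+ b))
    where
    h₁ : ∀ z k s b → (z + k * s - b + + 1 + + 1) - (z + + 0 * s - b - + 1 - + 1) ≡ k * s + + 4
    h₁ = solve-∀
    h₂ : ∀ z k s a b → (z + k * s - b + a) - (z + + 0 * s - a + b) ≡ k * s - + 2 * b + + 2 * a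
    h₂ = solve-∀
    h₃ : ∀ z k s a b → (z + k * s - b + + 1 + + 1) - (z + + 0 * s - a) ≡ k * s + + 2 - b + a
    h₃ = solve-∀

  -- v_b, v_a and v_{b+2} are each reached by two walks, from u₄ₖ (k = b₀, a₀, b₀) and from u₀.
  n∣P : + n ∣ᶻ P₁ × + n ∣ᶻ P₂ × + n ∣ᶻ P₃
  n∣P = congruences s₀
    (proj₂ (transfer b₀ 0 (blue ∷ red ∷ []) (red ∷ blue ∷ []) (refl , refl , ≋-reflexive v_b)))
    (proj₂ (transfer a₀ 0 (blue ∷ green ∷ blue ∷ red ∷ []) (red ∷ green ∷ []) (refl , refl , ≋-reflexive v_a)))
    (proj₂ (transfer b₀ 0 (blue ∷ green ∷ blue ∷ red ∷ []) (blue ∷ green ∷ red ∷ blue ∷ []) (refl , refl , ≋-reflexive v_b+2)))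
    where
    v_b : + b₀ * + 4 + + 1 ≡ + 0 * + 4 + + b
    v_b = trans (ℤₚ.+-comm (+ b₀ * + 4) (+ 1)) (trans (sym +b≡) (sym (ℤₚ.+-identityˡ (+ b))))
    v_a : + a₀ * + 4 + + 1 + + 1 + + 1 ≡ + 0 * + 4 + + a
    v_a = trans (three (+ a₀)) (trans (sym +a≡) (sym (ℤₚ.+-identityˡ (+ a))))
      where three : ∀ k → k * + 4 + + 1 + + 1 + + 1 ≡ + 3 + k * + 4
            three = solve-∀
    v_b+2 : + b₀ * + 4 + + 1 + + 1 + + 1 ≡ + 0 * + 4 + + 1 + + 1 + + b
    v_b+2 = trans (three (+ b₀)) (cong (λ u → + 2 + u) (sym +b≡))
      where three : ∀ k → k * + 4 + + 1 + + 1 + + 1 ≡ + 2 + (+ 1 + k * + 4)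
            three = solve-∀

module Sufficiency (n a b : ℕ) .{{_ : NonZero n}}
                   (n%2≡0 : n ℕ.% 2 ≡ 0) (a%2≡1 : a ℕ.% 2 ≡ 1) (b%2≡1 : b ℕ.% 2 ≡ 1)
                   (y≡a : yPar n a b ≡ a) (x≡b : xPar n a b ≡ b)
                   (q b₀ : ℕ) (a₀ : ℤ)
                   (+n≡q*8 : + n ≡ + q * + 8) (+b≡ : + b ≡ + 1 + + b₀ * + 4) (+a≡ : + a ≡ + 3 + a₀ * + 4)
                   (n∣P₁ : + n ∣ᶻ + b₀ * (+ 1 - + b) + + 4)
                   (n∣P₂ : + n ∣ᶻ + b₀ * (+ 1 - + b) - + 2 * + b + + 2 * + a)
                   (n∣P₃ : + n ∣ᶻ a₀ * (+ 1 - + b) + + 2 - + b + + a) where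

  open Colouring n a b (%2≡0⇒even n n%2≡0) (%2≡1⇒odd a a%2≡1) (%2≡1⇒odd b b%2≡1) y≡a x≡b

  n∣P₃′ : + n ∣ᶻ (a₀ + + 1) * σ + + a + + 1
  n∣P₃′ = subst (+ n ∣ᶻ_) (regroup a₀ (+ a) (+ b)) n∣P₃
    where regroup : ∀ a₀ a b → a₀ * (+ 1 - b) + + 2 - b + a ≡ (a₀ + + 1) * (+ 1 - b) + a + + 1
          regroup = solve-∀

  shift : ℤ → Pos → Pos
  shift k ⟨ S , p , z ⟩ = ⟨ S , p , k * σ + z ⟩

  -- F sends u_{4k+r} and v_{4k+r} to Φ₀ U r and Φ₀ V r translated by kσ.
  -- The last clause of each side also covers the unused residues r ≥ 4.
  Φ₀ : Side → ℕ → Pos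
  Φ₀ U 0 = ⟨ U , false , + 0 ⟩
  Φ₀ U 1 = ⟨ U , true , + 1 ⟩
  Φ₀ U 2 = ⟨ V , true , + 1 ⟩
  Φ₀ U (suc (suc (suc _))) = ⟨ V , false , σ ⟩
  Φ₀ V 0 = ⟨ U , true , - + 1 ⟩
  Φ₀ V 1 = ⟨ U , false , + 2 ⟩
  Φ₀ V 2 = ⟨ V , false , + 1 - + a ⟩
  Φ₀ V (suc (suc (suc _))) = ⟨ V , true , σ + + a ⟩

  Φ : Side → ℕ → ℤ → Pos
  Φ S r k = shift k (Φ₀ S r)

  F : Vertex n → Vertex n
  F (S , i) = vertex (Φ S (toℕ i ℕ.% 4) (+ (toℕ i ℕ./ 4)))

  consistent-Φ₀ : ∀ S r → Consistent (Φ₀ S r)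
  consistent-Φ₀ U 0 = divides (+ 0) refl
  consistent-Φ₀ U 1 = 1-odd
  consistent-Φ₀ U 2 = 1-odd
  consistent-Φ₀ U (suc (suc (suc _))) = σ-even
  consistent-Φ₀ V 0 = neg-odd 1-odd
  consistent-Φ₀ V 1 = divides (+ 1) refl
  consistent-Φ₀ V 2 = odd+odd 1-odd (neg-odd (%2≡1⇒odd a a%2≡1))
  consistent-Φ₀ V (suc (suc (suc _))) = even+odd σ-even (%2≡1⇒odd a a%2≡1)

  consistent-Φ : ∀ S r k → Consistent (Φ S r k)
  consistent-Φ S r k with Φ₀ S r | consistent-Φ₀ S r
  ... | ⟨ _ , false , _ ⟩ | cs = even+even (ℤ∣.∣n⇒∣m*n k σ-even) cs
  ... | ⟨ _ , true , _ ⟩ | cs = even+odd (ℤ∣.∣n⇒∣m*n k σ-even) cs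

  period : ℤ
  period = + q * + 2

  -- 4·period = n and period·σ = -b₀n, so F is well defined on indices modulo n.
  Φ-periodic : ∀ S r k j → vertex (Φ S r (k + j * period)) ≡ vertex (Φ S r k)
  Φ-periodic S r k j = vertex-≋ (side (Φ₀ S r)) {(k + j * period) * σ + z} {k * σ + z} (≋-from-∣ (divides (- j * + b₀) (begin
    (k + j * period) * σ + z - (k * σ + z)     ≡⟨ expand k j (+ q) z (+ b) ⟩
    j * (+ q * + 2 * (+ 1 - + b))              ≡⟨ cong (λ u → j * (+ q * + 2 * (+ 1 - u))) +b≡ ⟩
    j * (+ q * + 2 * (+ 1 - (+ 1 + + b₀ * + 4))) ≡⟨ collect j (+ q) (+ b₀) ⟩
    - j * + b₀ * (+ q * + 8)                   ≡⟨ cong (- j * + b₀ *_) (sym +n≡q*8) ⟩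
    - j * + b₀ * + n                           ∎)))
    where
    open ≡-Reasoning
    z : ℤ
    z = coord (Φ₀ S r)
    expand : ∀ k j q z b → (k + j * (q * + 2)) * (+ 1 - b) + z - (k * (+ 1 - b) + z) ≡ j * (q * + 2 * (+ 1 - b))
    expand = solve-∀
    collect : ∀ j q b₀ → j * (q * + 2 * (+ 1 - (+ 1 + b₀ * + 4))) ≡ - j * b₀ * (q * + 8)
    collect = solve-∀

  4k-even : ∀ k → Evenℤ (k * + 4)
  4k-even k = divides (k * + 2) (double k)
    where double : ∀ k → k * + 4 ≡ k * + 2 * + 2
          double = solve-∀

  pos : Side → ℕ → ℤ → Pos
  pos S r k = ⟨ S , isOdd r , + r + k * + 4 ⟩

  consistent-pos : ∀ S r k → r ℕ.< 4 → Consistent (pos S r k)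
  consistent-pos S 0 k _ = even+even (divides (+ 0) refl) (4k-even k)
  consistent-pos S 1 k _ = odd+even 1-odd (4k-even k)
  consistent-pos S 2 k _ = even+even (divides (+ 1) refl) (4k-even k)
  consistent-pos S 3 k _ = odd+even (odd-by {+ 3} (divides (+ 1) refl)) (4k-even k)
  consistent-pos S (suc (suc (suc (suc _)))) k (s≤s (s≤s (s≤s (s≤s ()))))

  F-pos : ∀ S r k → r ℕ.< 4 → F (vertex (pos S r k)) ≡ vertex (Φ S r k)
  F-pos S r k r<4 = trans (cong₂ (λ r′ k′ → vertex (Φ S r′ k′)) (proj₁ t-divMod) (proj₂ t-divMod)) (Φ-periodic S r k j)
    where
    open ≡-Reasoning
    z : ℤ
    z = + r + k * + 4
    t : ℕ
    t = toℕ (reduce z)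
    j : ℤ
    j = ℤ∣.quotient (_≋_.n∣x-y (toℕ-reduce-≋ z))
    split : ∀ t z → t ≡ z + (t - z)
    split = solve-∀
    regroup : ∀ r k j q → r + k * + 4 + j * (q * + 8) ≡ r + (k + j * (q * + 2)) * + 4
    regroup = solve-∀
    t-divMod : t ℕ.% 4 ≡ r × + (t ℕ./ 4) ≡ k + j * period
    t-divMod = divMod-unique (k + j * period) r<4 (begin
      + t                           ≡⟨ split (+ t) z ⟩
      z + (+ t - z)                 ≡⟨ cong (λ u → z + u) (ℤ∣._∣_.equality (_≋_.n∣x-y (toℕ-reduce-≋ z))) ⟩
      z + j * + n                   ≡⟨ cong (λ u → z + j * u) +n≡q*8 ⟩
      z + j * (+ q * + 8)           ≡⟨ regroup (+ r) k j (+ q) ⟩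
      + r + (k + j * period) * + 4  ∎)

  residue-induction : (P : Vertex n → Set) → (∀ S r k → r ℕ.< 4 → P (vertex (pos S r k))) → ∀ x → P x
  residue-induction P h (S , i) =
    subst P (cong (S ,_) (trans (cong reduce (sym (+-%-/ (toℕ i) 4))) (reduce-toℕ i)))
      (h S (toℕ i ℕ.% 4) (+ (toℕ i ℕ./ 4)) (ℕ.m%n<n (toℕ i) 4))

  -- To check F ∘ nbr c = nbr (swap c) ∘ F at the vertex with index 4k + r, write the index of its
  -- c-neighbour as 4k′ + r′ and compare the two images in the cover.
  commutes-at : ∀ c S r k r′ k′ → r ℕ.< 4 → r′ ℕ.< 4 →
                coord (move c (pos S r k)) ≡ + r′ + k′ * + 4 →
                side (Φ (side (move c (pos S r k))) r′ k′) ≡ side (move (swap c) (Φ S r k)) →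
                coord (Φ (side (move c (pos S r k))) r′ k′) ≋ coord (move (swap c) (Φ S r k)) →
                F (nbr c (vertex (pos S r k))) ≡ nbr (swap c) (F (vertex (pos S r k)))
  commutes-at c S r k r′ k′ r<4 r′<4 coord≡ side≡ coord≋ = begin
    F (nbr c (vertex (pos S r k)))            ≡⟨ cong F (nbr-vertex c (pos S r k) (consistent-pos S r k r<4)) ⟩
    F (vertex (move c (pos S r k)))           ≡⟨ cong (λ z → F (S′ , reduce z)) coord≡ ⟩
    F (vertex (pos S′ r′ k′))                 ≡⟨ F-pos S′ r′ k′ r′<4 ⟩
    vertex (Φ S′ r′ k′)                       ≡⟨ cong₂ _,_ side≡ (reduce-cong coord≋) ⟩
    vertex (move (swap c) (Φ S r k))          ≡⟨ sym (nbr-vertex (swap c) (Φ S r k) (consistent-Φ S r k)) ⟩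
    nbr (swap c) (vertex (Φ S r k))           ≡⟨ cong (nbr (swap c)) (sym (F-pos S r k r<4)) ⟩
    nbr (swap c) (F (vertex (pos S r k)))     ∎
    where
    open ≡-Reasoning
    S′ : Side
    S′ = side (move c (pos S r k))

  0<4 : 0 ℕ.< 4
  0<4 = s≤s z≤n
  1<4 : 1 ℕ.< 4
  1<4 = s≤s (s≤s z≤n)
  2<4 : 2 ℕ.< 4
  2<4 = s≤s (s≤s (s≤s z≤n))
  3<4 : 3 ℕ.< 4
  3<4 = s≤s (s≤s (s≤s (s≤s z≤n)))

  F-red : ∀ x → F (nbr red x) ≡ nbr green (F x)
  F-red = residue-induction _ table
    where
    table : ∀ S r k → r ℕ.< 4 → F (nbr red (vertex (pos S r k))) ≡ nbr green (F (vertex (pos S r k)))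
    table U 0 k _ = commutes-at red U 0 k 0 k 0<4 0<4 refl refl (≋-reflexive (images k σ))
            where images : ∀ k s → k * s + - + 1 ≡ k * s + + 0 - + 1
                  images = solve-∀
    table U 1 k _ = commutes-at red U 1 k 1 k 1<4 1<4 refl refl (≋-reflexive (images k σ))
            where images : ∀ k s → k * s + + 2 ≡ k * s + + 1 + + 1
                  images = solve-∀
    table U 2 k _ = commutes-at red U 2 k 2 k 2<4 2<4 refl refl (≋-reflexive (images k σ (+ a)))
            where images : ∀ k s A → k * s + (+ 1 - A) ≡ k * s + + 1 - A
                  images = solve-∀
    table U 3 k _ = commutes-at red U 3 k 3 k 3<4 3<4 refl refl (≋-reflexive (images k σ (+ a)))
            where images : ∀ k s A → k * s + (s + A) ≡ k * s + s + A
                  images = solve-∀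
    table V 0 k _ = commutes-at red V 0 k 0 k 0<4 0<4 refl refl (≋-reflexive (images k σ))
            where images : ∀ k s → k * s + + 0 ≡ k * s + - + 1 + + 1
                  images = solve-∀
    table V 1 k _ = commutes-at red V 1 k 1 k 1<4 1<4 refl refl (≋-reflexive (images k σ))
            where images : ∀ k s → k * s + + 1 ≡ k * s + + 2 - + 1
                  images = solve-∀
    table V 2 k _ = commutes-at red V 2 k 2 k 2<4 2<4 refl refl (≋-reflexive (images k σ (+ a)))
            where images : ∀ k s A → k * s + + 1 ≡ k * s + (+ 1 - A) + A
                  images = solve-∀
    table V 3 k _ = commutes-at red V 3 k 3 k 3<4 3<4 refl refl (≋-reflexive (images k σ (+ a)))
            where images : ∀ k s A → k * s + s ≡ k * s + (s + A) - A
                  images = solve-∀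
        
    table S (suc (suc (suc (suc _)))) k (s≤s (s≤s (s≤s (s≤s ()))))

  F-blue : ∀ x → F (nbr blue x) ≡ nbr blue (F x)
  F-blue = residue-induction _ table
    where
    table : ∀ S r k → r ℕ.< 4 → F (nbr blue (vertex (pos S r k))) ≡ nbr blue (F (vertex (pos S r k)))
    table U 0 k _ = commutes-at blue U 0 k 1 k 0<4 1<4 (residue k) refl (≋-reflexive (images k σ))
            where residue : ∀ k → + 0 + k * + 4 + + 1 ≡ + 1 + k * + 4
                  residue = solve-∀
                  images : ∀ k s → k * s + + 1 ≡ k * s + + 0 + + 1
                  images = solve-∀
    table U 1 k _ = commutes-at blue U 1 k 0 k 1<4 0<4 (residue k) refl (≋-reflexive (images k σ))
            where residue : ∀ k → + 1 + k * + 4 - + 1 ≡ + 0 + k * + 4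
                  residue = solve-∀
                  images : ∀ k s → k * s + + 0 ≡ k * s + + 1 - + 1
                  images = solve-∀
    table U 2 k _ = commutes-at blue U 2 k 3 k 2<4 3<4 (residue k) refl (≋-reflexive (images k (+ b)))
            where residue : ∀ k → + 2 + k * + 4 + + 1 ≡ + 3 + k * + 4
                  residue = solve-∀
                  images : ∀ k B → k * (+ 1 - B) + (+ 1 - B) ≡ k * (+ 1 - B) + + 1 - B
                  images = solve-∀
    table U 3 k _ = commutes-at blue U 3 k 2 k 3<4 2<4 (residue k) refl (≋-reflexive (images k (+ b)))
            where residue : ∀ k → + 3 + k * + 4 - + 1 ≡ + 2 + k * + 4
                  residue = solve-∀
                  images : ∀ k B → k * (+ 1 - B) + + 1 ≡ k * (+ 1 - B) + (+ 1 - B) + B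
                  images = solve-∀
    table V 0 k _ = commutes-at blue V 0 k 1 (k + + b₀) 0<4 1<4
      (trans (cong (λ u → + 0 + k * + 4 + u) +b≡) (residue k (+ b₀))) refl
      (≋-multiple (+ 1) n∣P₁ (images k (+ b₀) σ))
            where residue : ∀ k b0 → + 0 + k * + 4 + (+ 1 + b0 * + 4) ≡ + 1 + (k + b0) * + 4
                  residue = solve-∀
                  images : ∀ k b0 s → ((k + b0) * s + + 2) - (k * s + - + 1 - + 1) ≡ + 1 * (b0 * s + + 4)
                  images = solve-∀
    table V 1 k _ = commutes-at blue V 1 k 0 (k - + b₀) 1<4 0<4
      (trans (cong (λ u → + 1 + k * + 4 - u) +b≡) (residue k (+ b₀))) refl
      (≋-multiple (- + 1) n∣P₁ (images k (+ b₀) σ))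
            where residue : ∀ k b0 → + 1 + k * + 4 - (+ 1 + b0 * + 4) ≡ + 0 + (k - b0) * + 4
                  residue = solve-∀
                  images : ∀ k b0 s → ((k - b0) * s + - + 1) - (k * s + + 2 + + 1) ≡ - + 1 * (b0 * s + + 4)
                  images = solve-∀
    table V 2 k _ = commutes-at blue V 2 k 3 (k + + b₀) 2<4 3<4
      (trans (cong (λ u → + 2 + k * + 4 + u) +b≡) (residue k (+ b₀))) refl
      (≋-multiple (+ 1) n∣P₂ (images k (+ b₀) (+ a) (+ b)))
            where residue : ∀ k b0 → + 2 + k * + 4 + (+ 1 + b0 * + 4) ≡ + 3 + (k + b0) * + 4
                  residue = solve-∀
                  images : ∀ k b0 A B → ((k + b0) * (+ 1 - B) + ((+ 1 - B) + A)) - (k * (+ 1 - B) + (+ 1 - A) + B) ≡ + 1 * (b0 * (+ 1 - B) - + 2 * B + + 2 * A)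
                  images = solve-∀
    table V 3 k _ = commutes-at blue V 3 k 2 (k - + b₀) 3<4 2<4
      (trans (cong (λ u → + 3 + k * + 4 - u) +b≡) (residue k (+ b₀))) refl
      (≋-multiple (- + 1) n∣P₂ (images k (+ b₀) (+ a) (+ b)))
            where residue : ∀ k b0 → + 3 + k * + 4 - (+ 1 + b0 * + 4) ≡ + 2 + (k - b0) * + 4
                  residue = solve-∀
                  images : ∀ k b0 A B → ((k - b0) * (+ 1 - B) + (+ 1 - A)) - (k * (+ 1 - B) + ((+ 1 - B) + A) - B) ≡ - + 1 * (b0 * (+ 1 - B) - + 2 * B + + 2 * A)
                  images = solve-∀
        
    table S (suc (suc (suc (suc _)))) k (s≤s (s≤s (s≤s (s≤s ()))))

  F-green : ∀ x → F (nbr green x) ≡ nbr red (F x)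
  F-green = residue-induction _ table
    where
    table : ∀ S r k → r ℕ.< 4 → F (nbr green (vertex (pos S r k))) ≡ nbr red (F (vertex (pos S r k)))
    table U 0 k _ = commutes-at green U 0 k 3 (k - + 1) 0<4 3<4
      (residue k) refl
      (≋-reflexive (images k (+ b)))
            where residue : ∀ k → + 0 + k * + 4 - + 1 ≡ + 3 + (k - + 1) * + 4
                  residue = solve-∀
                  images : ∀ k B → (k - + 1) * (+ 1 - B) + (+ 1 - B) ≡ k * (+ 1 - B) + + 0
                  images = solve-∀
    table U 1 k _ = commutes-at green U 1 k 2 k 1<4 2<4 (residue k) refl ≋-refl
            where residue : ∀ k → + 1 + k * + 4 + + 1 ≡ + 2 + k * + 4
                  residue = solve-∀
    table U 2 k _ = commutes-at green U 2 k 1 k 2<4 1<4 (residue k) refl ≋-refl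
            where residue : ∀ k → + 2 + k * + 4 - + 1 ≡ + 1 + k * + 4
                  residue = solve-∀
    table U 3 k _ = commutes-at green U 3 k 0 (k + + 1) 3<4 0<4 (residue k) refl (≋-reflexive (images k σ))
            where residue : ∀ k → + 3 + k * + 4 + + 1 ≡ + 0 + (k + + 1) * + 4
                  residue = solve-∀
                  images : ∀ k s → (k + + 1) * s + + 0 ≡ k * s + s
                  images = solve-∀
    table V 0 k _ = commutes-at green V 0 k 3 (k + a₀) 0<4 3<4
      (trans (cong (λ u → + 0 + k * + 4 + u) +a≡) (residue k a₀)) refl
      (≋-multiple (+ 1) n∣P₃′ (images k a₀ (+ a) σ))
            where residue : ∀ k a0 → + 0 + k * + 4 + (+ 3 + a0 * + 4) ≡ + 3 + (k + a0) * + 4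
                  residue = solve-∀
                  images : ∀ k a0 A s → ((k + a0) * s + (s + A)) - (k * s + - + 1) ≡ + 1 * ((a0 + + 1) * s + A + + 1)
                  images = solve-∀
    table V 1 k _ = commutes-at green V 1 k 2 (k - a₀ - + 1) 1<4 2<4
      (trans (cong (λ u → + 1 + k * + 4 - u) +a≡) (residue k a₀)) refl
      (≋-multiple (- + 1) n∣P₃′ (images k a₀ (+ a) σ))
            where residue : ∀ k a0 → + 1 + k * + 4 - (+ 3 + a0 * + 4) ≡ + 2 + (k - a0 - + 1) * + 4
                  residue = solve-∀
                  images : ∀ k a0 A s → ((k - a0 - + 1) * s + (+ 1 - A)) - (k * s + + 2) ≡ - + 1 * ((a0 + + 1) * s + A + + 1)
                  images = solve-∀
    table V 2 k _ = commutes-at green V 2 k 1 (k + a₀ + + 1) 2<4 1<4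
      (trans (cong (λ u → + 2 + k * + 4 + u) +a≡) (residue k a₀)) refl
      (≋-multiple (+ 1) n∣P₃′ (images k a₀ (+ a) σ))
            where residue : ∀ k a0 → + 2 + k * + 4 + (+ 3 + a0 * + 4) ≡ + 1 + (k + a0 + + 1) * + 4
                  residue = solve-∀
                  images : ∀ k a0 A s → ((k + a0 + + 1) * s + + 2) - (k * s + (+ 1 - A)) ≡ + 1 * ((a0 + + 1) * s + A + + 1)
                  images = solve-∀
    table V 3 k _ = commutes-at green V 3 k 0 (k - a₀) 3<4 0<4
      (trans (cong (λ u → + 3 + k * + 4 - u) +a≡) (residue k a₀)) refl
      (≋-multiple (- + 1) n∣P₃′ (images k a₀ (+ a) σ))
            where residue : ∀ k a0 → + 3 + k * + 4 - (+ 3 + a0 * + 4) ≡ + 0 + (k - a0) * + 4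
                  residue = solve-∀
                  images : ∀ k a0 A s → ((k - a0) * s + - + 1) - (k * s + (s + A)) ≡ - + 1 * ((a0 + + 1) * s + A + + 1)
                  images = solve-∀
        
    table S (suc (suc (suc (suc _)))) k (s≤s (s≤s (s≤s (s≤s ()))))

  F-nbr : ∀ c x → F (nbr c x) ≡ nbr (swap c) (F x)
  F-nbr red = F-red
  F-nbr blue = F-blue
  F-nbr green = F-green

  F∘F-nbr : ∀ c x → F (F (nbr c x)) ≡ nbr c (F (F x))
  F∘F-nbr c x = trans (cong F (F-nbr c x))
                  (trans (F-nbr (swap c) (F x)) (cong (λ c′ → nbr c′ (F (F x))) (swap-involutive c)))

  rim-step : ∀ t → ∃ λ c → (U , reduce (+ suc t)) ≡ nbr c (U , reduce (+ t))
  rim-step t = [ (λ t-even → blue , step blue false (%2≡0⇒even t t-even) refl) ,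
                 (λ t-odd → green , step green true (%2≡1⇒odd t t-odd) refl) ]′ (%2≡0⊎%2≡1 t)
    where
    step : ∀ c p → Consistent ⟨ U , p , + t ⟩ → move c ⟨ U , p , + t ⟩ ≡ ⟨ U , not p , + t + + 1 ⟩ →
           (U , reduce (+ suc t)) ≡ nbr c (U , reduce (+ t))
    step c p cs move≡ = sym (begin
      nbr c (vertex ⟨ U , p , + t ⟩)          ≡⟨ nbr-vertex c ⟨ U , p , + t ⟩ cs ⟩
      vertex (move c ⟨ U , p , + t ⟩)         ≡⟨ cong vertex move≡ ⟩
      (U , reduce (+ (t ℕ.+ 1)))              ≡⟨ cong (λ m → (U , reduce (+ m))) (ℕₚ.+-comm t 1) ⟩
      (U , reduce (+ suc t))                  ∎)
      where open ≡-Reasoning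

  F-u₀ : F (U , reduce (+ 0)) ≡ (U , reduce (+ 0))
  F-u₀ = F-pos U 0 (+ 0) 0<4

  -- F ∘ F commutes with every matching and fixes u₀, so it fixes everything reachable from u₀.
  F∘F-rim : ∀ t → F (F (U , reduce (+ t))) ≡ (U , reduce (+ t))
  F∘F-rim zero = trans (cong F F-u₀) F-u₀
  F∘F-rim (suc t) = along (rim-step t)
    where
    open ≡-Reasoning
    along : (∃ λ c → (U , reduce (+ suc t)) ≡ nbr c (U , reduce (+ t))) → F (F (U , reduce (+ suc t))) ≡ (U , reduce (+ suc t))
    along (c , u₊≡) = begin
      F (F (U , reduce (+ suc t)))        ≡⟨ cong (λ x → F (F x)) u₊≡ ⟩
      F (F (nbr c (U , reduce (+ t))))    ≡⟨ F∘F-nbr c (U , reduce (+ t)) ⟩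
      nbr c (F (F (U , reduce (+ t))))    ≡⟨ cong (nbr c) (F∘F-rim t) ⟩
      nbr c (U , reduce (+ t))            ≡⟨ sym u₊≡ ⟩
      (U , reduce (+ suc t))              ∎

  F∘F : ∀ x → F (F x) ≡ x
  F∘F (U , i) = subst (λ x → F (F x) ≡ x) (cong (U ,_) (reduce-toℕ i)) (F∘F-rim (toℕ i))
  F∘F (V , i) = begin
    F (F (V , i))                ≡⟨ cong (λ x → F (F x)) (sym red-U) ⟩
    F (F (nbr red (U , i)))      ≡⟨ F∘F-nbr red (U , i) ⟩
    nbr red (F (F (U , i)))      ≡⟨ cong (nbr red) (F∘F (U , i)) ⟩
    nbr red (U , i)              ≡⟨ red-U ⟩
    (V , i)                      ∎
    where
    open ≡-Reasoning
    red-U : nbr red (U , i) ≡ (V , i)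
    red-U = vertex-toℕ V (isOdd (toℕ i)) i

  F-reflects : ∀ c {x y} → F y ≡ nbr c (F x) → y ≡ nbr (swap c) x
  F-reflects c {x} {y} eq =
    trans (sym (F∘F y)) (trans (cong F eq) (trans (F-nbr c (F x)) (cong (nbr (swap c)) (F∘F x))))

  F-preserves : ∀ c {x y} → y ≡ nbr c x → F y ≡ nbr (swap c) (F x)
  F-preserves c {x} refl = F-nbr c x

  F-Adj : ∀ x y → MO.Adj n a b x y ⇔ MO.Adj n a b (F x) (F y)
  F-Adj x y = mk⇔ (λ adj → let (c , y≡) = Equivalence.to Adj⇔nbr adj in Equivalence.from Adj⇔nbr (swap c , F-preserves c y≡))
                  (λ adj → let (c , Fy≡) = Equivalence.to Adj⇔nbr adj in Equivalence.from Adj⇔nbr (swap c , F-reflects c Fy≡))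

  automorphism : MO.Automorphism n a b
  automorphism = record { f = F ; f⁻¹ = F ; left = F∘F ; right = F∘F ; adj = F-Adj }

  order-two : MO.HasOrder2 n a b automorphism
  order-two = F∘F , ((U , reduce (+ 2)) , λ F-fixes → flip≢ U (trans (sym (cong proj₁ (F-pos U 2 (+ 0) 2<4))) (cong proj₁ F-fixes)))

  swaps-classes : ∀ c → MO.MapsOnto n a b automorphism (Class c) (Class (swap c))
  swaps-classes c x y = mk⇔
    (λ xy → Equivalence.from (class⇔nbr (swap c)) (F-preserves c (class⇒nbr c xy)))
    (λ FxFy → Equivalence.from (class⇔nbr c)
                (subst (λ c′ → y ≡ nbr c′ x) (swap-involutive c) (F-reflects (swap c) (class⇒nbr (swap c) FxFy))))

module Arithmetic (n m a b a₀ b₀ : ℕ) .{{_ : NonZero n}}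
                  (+n≡m*4 : + n ≡ + m * + 4) (+b≡ : + b ≡ + 1 + + b₀ * + 4) (+a≡ : + a ≡ + 3 + + a₀ * + 4)
                  (a<b : a ℕ.< b) (b<n : b ℕ.< n) (a+b<n : a ℕ.+ b ℕ.< n)
                  (n∣P₁ : + n ∣ᶻ + b₀ * (+ 1 - + b) + + 4)
                  (n∣P₂ : + n ∣ᶻ + b₀ * (+ 1 - + b) - + 2 * + b + + 2 * + a)
                  (n∣P₃ : + n ∣ᶻ + a₀ * (+ 1 - + b) + + 2 - + b + + a) where

  open Modulo n

  n≡m*4 : n ≡ m ℕ.* 4
  n≡m*4 = ℤₚ.+-injective (trans +n≡m*4 (sym (ℤₚ.pos-* m 4)))

  a≤b+2 : a ℕ.≤ b ℕ.+ 2
  a≤b+2 = ℕₚ.≤-trans (ℕₚ.<⇒≤ a<b) (ℕₚ.m≤m+n b 2)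

  gap : ℕ
  gap = b ℕ.+ 2 ℕ.∸ a

  b≡4b₀+1 : b ≡ 4 ℕ.* b₀ ℕ.+ 1
  b≡4b₀+1 = ℤₚ.+-injective (trans +b≡ (trans (ℤₚ.+-comm (+ 1) (+ b₀ * + 4))
              (cong (_+ + 1) (trans (ℤₚ.*-comm (+ b₀) (+ 4)) (sym (ℤₚ.pos-* 4 b₀))))))

  +gap≡ : + gap ≡ + b + + 2 - + a
  +gap≡ = sym (trans (ℤₚ.m-n≡m⊖n (b ℕ.+ 2) a) (ℤₚ.⊖-≥ a≤b+2))

  n∣gap*2 : n ∣ gap ℕ.* 2
  n∣gap*2 = ℤ∣.∣⇒∣ᵤ (subst (+ n ∣ᶻ_) (trans (difference (+ b₀) (+ a) (+ b)) (sym eq)) (ℤ∣.∣m∣n⇒∣m-n n∣P₁ n∣P₂))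
    where
    difference : ∀ b₀ a b → (b₀ * (+ 1 - b) + + 4) - (b₀ * (+ 1 - b) - + 2 * b + + 2 * a) ≡ (b + + 2 - a) * + 2
    difference = solve-∀
    eq : + (gap ℕ.* 2) ≡ (+ b + + 2 - + a) * + 2
    eq = trans (ℤₚ.pos-* gap 2) (cong (_* + 2) +gap≡)

  3≤a : 3 ℕ.≤ a
  3≤a = ℕₚ.≤-trans (ℕₚ.m≤m+n 3 (a₀ ℕ.* 4))
          (ℕₚ.≤-reflexive (ℤₚ.+-injective (trans (cong (λ u → + 3 + u) (ℤₚ.pos-* a₀ 4)) (sym +a≡))))

  gap<n : gap ℕ.< n
  gap<n = ℕₚ.+-cancelʳ-< a gap n (subst (ℕ._< n ℕ.+ a) (sym (ℕₚ.m∸n+n≡m a≤b+2))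
            (ℕₚ.<-≤-trans (ℕₚ.+-mono-< b<n (ℕₚ.n<1+n 2)) (ℕₚ.+-monoʳ-≤ n 3≤a)))

  gap≡m*2 : gap ≡ m ℕ.* 2
  gap≡m*2 = divisor-unique (ℕ∣.*-cancelʳ-∣ 2 (subst (_∣ gap ℕ.* 2) (trans n≡m*4 (sym (ℕₚ.*-assoc m 2 2))) n∣gap*2))
              (ℕₚ.m<n⇒0<n∸m (ℕₚ.<-trans a<b (ℕₚ.m<m+n b (s≤s z≤n))))
              (subst (gap ℕ.<_) (trans n≡m*4 (double m)) gap<n)
    where
    double : ∀ m → m ℕ.* 4 ≡ m ℕ.* 2 ℕ.+ m ℕ.* 2
    double = ℕ-Solver.solve-∀

  n/2≡m*2 : n ℕ./ 2 ≡ m ℕ.* 2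
  n/2≡m*2 = trans (cong (ℕ._/ 2) (trans n≡m*4 (sym (ℕₚ.*-assoc m 2 2)))) (ℕ.m*n/n≡m (m ℕ.* 2) 2)

  a+n/2≡b+2 : a ℕ.+ n ℕ./ 2 ≡ b ℕ.+ 2
  a+n/2≡b+2 = trans (cong (a ℕ.+_) (trans n/2≡m*2 (sym gap≡m*2))) (ℕₚ.m+[n∸m]≡n a≤b+2)

  +m≡ : + m ≡ (+ b₀ - + a₀) * + 2
  +m≡ = ℤₚ.*-cancelʳ-≡ (+ m) ((+ b₀ - + a₀) * + 2) (+ 2) (begin
    + m * + 2                          ≡⟨ sym (ℤₚ.pos-* m 2) ⟩
    + (m ℕ.* 2)                        ≡⟨ cong +_ (sym gap≡m*2) ⟩
    + gap                              ≡⟨ +gap≡ ⟩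
    + b + + 2 - + a                    ≡⟨ cong₂ (λ u v → u + + 2 - v) +b≡ +a≡ ⟩
    + 1 + + b₀ * + 4 + + 2 - (+ 3 + + a₀ * + 4) ≡⟨ regroup (+ b₀) (+ a₀) ⟩
    (+ b₀ - + a₀) * + 2 * + 2          ∎)
    where
    open ≡-Reasoning
    regroup : ∀ b₀ a₀ → + 1 + b₀ * + 4 + + 2 - (+ 3 + a₀ * + 4) ≡ (b₀ - a₀) * + 2 * + 2
    regroup = solve-∀

  m-even : m ℕ.% 2 ≡ 0
  m-even = even⇒%2≡0 {m} (divides (+ b₀ - + a₀) +m≡)

  k : ℕ
  k = m ℕ./ 2

  m≡k*2 : m ≡ k ℕ.* 2
  m≡k*2 = trans (ℕ.m≡m%n+[m/n]*n m 2) (cong (ℕ._+ k ℕ.* 2) m-even)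

  8∣n : 8 ∣ n
  8∣n = divides k (trans n≡m*4 (trans (cong (ℕ._* 4) m≡k*2) (ℕₚ.*-assoc k 2 4)))

  +a₀≡ : + a₀ ≡ + b₀ - + k
  +a₀≡ = trans (regroup (+ a₀) (+ b₀))
           (cong (λ u → + b₀ - u) (sym (ℤₚ.*-cancelʳ-≡ (+ k) (+ b₀ - + a₀) (+ 2)
             (trans (sym (trans (cong +_ m≡k*2) (ℤₚ.pos-* k 2))) +m≡))))
    where
    regroup : ∀ a₀ b₀ → a₀ ≡ b₀ - (b₀ - a₀)
    regroup = solve-∀

  k≢0 : k ≢ 0
  k≢0 k≡0 = ℕ.≢-nonZero⁻¹ n (trans n≡m*4 (cong (ℕ._* 4) (trans m≡k*2 (cong (ℕ._* 2) k≡0))))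

  -- Subtracting P₁ from P₃ leaves 4k(b₀ - 1), a multiple of n = 8k only if b₀ is odd.
  b₀-odd : b₀ ℕ.% 2 ≡ 1
  b₀-odd = odd⇒%2≡1 {b₀} (odd-by (ℤ∣.*-cancelˡ-∣ (+ k * + 4) {+ 2} {+ b₀ - + 1} {{ℤ.≢-nonZero 4k≢0}}
             (subst₂ _∣ᶻ_ +n≡8k P₃-P₁≡ (ℤ∣.∣m∣n⇒∣m-n n∣P₃ n∣P₁))))
    where
    open ≡-Reasoning
    4k≢0 : + k * + 4 ≢ + 0
    4k≢0 eq = k≢0 (ℕₚ.m*n≡0⇒m≡0 k 4 (ℤₚ.+-injective (trans (ℤₚ.pos-* k 4) eq)))
    +n≡8k : + n ≡ + k * + 4 * + 2
    +n≡8k = trans +n≡m*4 (trans (cong (λ u → u * + 4) (trans (cong +_ m≡k*2) (ℤₚ.pos-* k 2))) (reassoc (+ k)))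
      where reassoc : ∀ k → k * + 2 * + 4 ≡ k * + 4 * + 2
            reassoc = solve-∀
    P₃-P₁ : ℤ → ℤ → ℤ → ℤ
    P₃-P₁ a₀ a b = (a₀ * (+ 1 - b) + + 2 - b + a) - (+ b₀ * (+ 1 - b) + + 4)
    factor : ∀ b₀ k → ((b₀ - k) * (+ 1 - (+ 1 + b₀ * + 4)) + + 2 - (+ 1 + b₀ * + 4) + (+ 3 + (b₀ - k) * + 4))
                        - (b₀ * (+ 1 - (+ 1 + b₀ * + 4)) + + 4) ≡ k * + 4 * (b₀ - + 1)
    factor = solve-∀
    P₃-P₁≡ : P₃-P₁ (+ a₀) (+ a) (+ b) ≡ + k * + 4 * (+ b₀ - + 1)
    P₃-P₁≡ = begin
      P₃-P₁ (+ a₀) (+ a) (+ b)                                         ≡⟨ cong (λ u → P₃-P₁ (+ a₀) u (+ b)) +a≡ ⟩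
      P₃-P₁ (+ a₀) (+ 3 + + a₀ * + 4) (+ b)                            ≡⟨ cong (λ u → P₃-P₁ u (+ 3 + u * + 4) (+ b)) +a₀≡ ⟩
      P₃-P₁ (+ b₀ - + k) (+ 3 + (+ b₀ - + k) * + 4) (+ b)              ≡⟨ cong (P₃-P₁ (+ b₀ - + k) (+ 3 + (+ b₀ - + k) * + 4)) +b≡ ⟩
      P₃-P₁ (+ b₀ - + k) (+ 3 + (+ b₀ - + k) * + 4) (+ 1 + + b₀ * + 4) ≡⟨ factor (+ b₀) (+ k) ⟩
      + k * + 4 * (+ b₀ - + 1)                                         ∎

  4b₀²≡4 : + (4 ℕ.* b₀ ℕ.* b₀) ≡ + 4 [mod n ]
  4b₀²≡4 = ≋⇒≡[mod] {+ (4 ℕ.* b₀ ℕ.* b₀)} {+ 4} (≋-from-∣ (subst (+ n ∣ᶻ_) eq (ℤ∣.∣m⇒∣-m n∣P₁)))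
    where
    open ≡-Reasoning
    expand : ∀ b₀ → - (b₀ * (+ 1 - (+ 1 + b₀ * + 4)) + + 4) ≡ + 4 * b₀ * b₀ - + 4
    expand = solve-∀
    eq : - (+ b₀ * (+ 1 - + b) + + 4) ≡ + (4 ℕ.* b₀ ℕ.* b₀) - + 4
    eq = begin
      - (+ b₀ * (+ 1 - + b) + + 4)                    ≡⟨ cong (λ u → - (+ b₀ * (+ 1 - u) + + 4)) +b≡ ⟩
      - (+ b₀ * (+ 1 - (+ 1 + + b₀ * + 4)) + + 4)     ≡⟨ expand (+ b₀) ⟩
      + 4 * + b₀ * + b₀ - + 4                         ≡⟨ cong (_- + 4) (sym (trans (ℤₚ.pos-* (4 ℕ.* b₀) b₀) (cong (_* + b₀) (ℤₚ.pos-* 4 b₀)))) ⟩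
      + (4 ℕ.* b₀ ℕ.* b₀) - + 4                       ∎

  4b+4<3n : 4 ℕ.* b ℕ.+ 4 ℕ.< 3 ℕ.* n
  4b+4<3n = subst₂ ℕ._<_ 2[a+b]+n≡4b+4 (thrice n) (ℕₚ.+-monoˡ-< n (ℕₚ.*-monoʳ-< 2 a+b<n))
    where
    open ≡-Reasoning
    thrice : ∀ n → 2 ℕ.* n ℕ.+ n ≡ 3 ℕ.* n
    thrice = ℕ-Solver.solve-∀
    regroup : ∀ a b h → 2 ℕ.* (a ℕ.+ b) ℕ.+ h ℕ.* 2 ≡ 2 ℕ.* b ℕ.+ 2 ℕ.* (a ℕ.+ h)
    regroup = ℕ-Solver.solve-∀
    collect : ∀ b → 2 ℕ.* b ℕ.+ 2 ℕ.* (b ℕ.+ 2) ≡ 4 ℕ.* b ℕ.+ 4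
    collect = ℕ-Solver.solve-∀
    n≡n/2*2 : n ≡ n ℕ./ 2 ℕ.* 2
    n≡n/2*2 = trans n≡m*4 (trans (sym (ℕₚ.*-assoc m 2 2)) (cong (ℕ._* 2) (sym n/2≡m*2)))
    2[a+b]+n≡4b+4 : 2 ℕ.* (a ℕ.+ b) ℕ.+ n ≡ 4 ℕ.* b ℕ.+ 4
    2[a+b]+n≡4b+4 = begin
      2 ℕ.* (a ℕ.+ b) ℕ.+ n                 ≡⟨ cong (2 ℕ.* (a ℕ.+ b) ℕ.+_) n≡n/2*2 ⟩
      2 ℕ.* (a ℕ.+ b) ℕ.+ n ℕ./ 2 ℕ.* 2      ≡⟨ regroup a b (n ℕ./ 2) ⟩
      2 ℕ.* b ℕ.+ 2 ℕ.* (a ℕ.+ n ℕ./ 2)      ≡⟨ cong (λ u → 2 ℕ.* b ℕ.+ 2 ℕ.* u) a+n/2≡b+2 ⟩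
      2 ℕ.* b ℕ.+ 2 ℕ.* (b ℕ.+ 2)            ≡⟨ collect b ⟩
      4 ℕ.* b ℕ.+ 4                          ∎

module Converse (n a b q b₀ : ℕ) .{{_ : NonZero n}}
                (n≡q*8 : n ≡ q ℕ.* 8) (b≡ : b ≡ 4 ℕ.* b₀ ℕ.+ 1) (b₀%2≡1 : b₀ ℕ.% 2 ≡ 1)
                (4b₀²≡4 : + (4 ℕ.* b₀ ℕ.* b₀) ≡ + 4 [mod n ]) (a+n/2≡b+2 : a ℕ.+ n ℕ./ 2 ≡ b ℕ.+ 2) where

  +n≡q*8 : + n ≡ + q * + 8
  +n≡q*8 = trans (cong +_ n≡q*8) (ℤₚ.pos-* q 8)

  +b≡ : + b ≡ + 1 + + b₀ * + 4
  +b≡ = trans (cong +_ b≡) (trans (cong (_+ + 1) (ℤₚ.pos-* 4 b₀)) (reorder (+ b₀)))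
    where reorder : ∀ x → + 4 * x + + 1 ≡ + 1 + x * + 4
          reorder = solve-∀

  a₀ : ℤ
  a₀ = + b₀ - + q

  n/2≡q*4 : n ℕ./ 2 ≡ q ℕ.* 4
  n/2≡q*4 = trans (cong (ℕ._/ 2) (trans n≡q*8 (sym (ℕₚ.*-assoc q 4 2)))) (ℕ.m*n/n≡m (q ℕ.* 4) 2)

  +a≡ : + a ≡ + 3 + a₀ * + 4
  +a≡ = begin
    + a                                  ≡⟨ isolate (+ a) (+ q * + 4) ⟩
    (+ a + + q * + 4) - + q * + 4        ≡⟨ cong (λ u → (+ a + u) - + q * + 4) (sym (ℤₚ.pos-* q 4)) ⟩
    + (a ℕ.+ q ℕ.* 4) - + q * + 4        ≡⟨ cong (λ u → + u - + q * + 4) a+4q≡ ⟩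
    + (4 ℕ.* b₀ ℕ.+ 1 ℕ.+ 2) - + q * + 4 ≡⟨ cong (λ u → u + + 1 + + 2 - + q * + 4) (ℤₚ.pos-* 4 b₀) ⟩
    + 4 * + b₀ + + 1 + + 2 - + q * + 4   ≡⟨ regroup (+ b₀) (+ q) ⟩
    + 3 + a₀ * + 4                       ∎
    where
    open ≡-Reasoning
    isolate : ∀ a u → a ≡ (a + u) - u
    isolate = solve-∀
    regroup : ∀ b₀ q → + 4 * b₀ + + 1 + + 2 - q * + 4 ≡ + 3 + (b₀ - q) * + 4
    regroup = solve-∀
    a+4q≡ : a ℕ.+ q ℕ.* 4 ≡ 4 ℕ.* b₀ ℕ.+ 1 ℕ.+ 2
    a+4q≡ = trans (cong (a ℕ.+_) (sym n/2≡q*4)) (trans a+n/2≡b+2 (cong (ℕ._+ 2) b≡))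

  X : ℤ
  X = + 4 * + b₀ * + b₀ - + 4

  n∣X : + n ∣ᶻ X
  n∣X = subst (λ u → + n ∣ᶻ u - + 4) (trans (ℤₚ.pos-* (4 ℕ.* b₀) b₀) (cong (_* + b₀) (ℤₚ.pos-* 4 b₀)))
          (ℤ∣.∣ᵤ⇒∣ 4b₀²≡4)

  n∣P₁ : + n ∣ᶻ + b₀ * (+ 1 - + b) + + 4
  n∣P₁ = subst (+ n ∣ᶻ_) (trans (expand (+ b₀)) (cong (λ u → + b₀ * (+ 1 - u) + + 4) (sym +b≡))) (ℤ∣.∣m⇒∣-m n∣X)
    where expand : ∀ b₀ → - (+ 4 * b₀ * b₀ - + 4) ≡ b₀ * (+ 1 - (+ 1 + b₀ * + 4)) + + 4
          expand = solve-∀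

  n∣P₂ : + n ∣ᶻ + b₀ * (+ 1 - + b) - + 2 * + b + + 2 * + a
  n∣P₂ = subst (+ n ∣ᶻ_) eq (ℤ∣.∣m∣n⇒∣m-n (ℤ∣.∣m⇒∣-m n∣X) ℤ∣.∣-refl)
    where
    open ≡-Reasoning
    P₂ : ℤ → ℤ → ℤ
    P₂ a b = + b₀ * (+ 1 - b) - + 2 * b + + 2 * a
    expand : ∀ b₀ q → - (+ 4 * b₀ * b₀ - + 4) - q * + 8 ≡
                      b₀ * (+ 1 - (+ 1 + b₀ * + 4)) - + 2 * (+ 1 + b₀ * + 4) + + 2 * (+ 3 + (b₀ - q) * + 4)
    expand = solve-∀
    eq : - X - + n ≡ P₂ (+ a) (+ b)
    eq = begin
      - X - + n                                   ≡⟨ cong (λ u → - X - u) +n≡q*8 ⟩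
      - X - + q * + 8                             ≡⟨ expand (+ b₀) (+ q) ⟩
      P₂ (+ 3 + a₀ * + 4) (+ 1 + + b₀ * + 4)      ≡⟨ sym (cong₂ P₂ +a≡ +b≡) ⟩
      P₂ (+ a) (+ b)                              ∎

  -- P₃ differs from -X by 4q(b₀ - 1), which is a multiple of n = 8q because b₀ is odd.
  n∣4q[b₀-1] : + n ∣ᶻ + q * + 4 * (+ b₀ - + 1)
  n∣4q[b₀-1] = divides (+ (b₀ ℕ./ 2)) (begin
    + q * + 4 * (+ b₀ - + 1)                                ≡⟨ cong (λ u → + q * + 4 * (u - + 1)) (+-%-/ b₀ 2) ⟩
    + q * + 4 * (+ (b₀ ℕ.% 2) + + (b₀ ℕ./ 2) * + 2 - + 1)   ≡⟨ cong (λ r → + q * + 4 * (+ r + + (b₀ ℕ./ 2) * + 2 - + 1)) b₀%2≡1 ⟩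
    + q * + 4 * (+ 1 + + (b₀ ℕ./ 2) * + 2 - + 1)            ≡⟨ regroup (+ q) (+ (b₀ ℕ./ 2)) ⟩
    + (b₀ ℕ./ 2) * (+ q * + 8)                              ≡⟨ cong (+ (b₀ ℕ./ 2) *_) (sym +n≡q*8) ⟩
    + (b₀ ℕ./ 2) * + n                                      ∎)
    where
    open ≡-Reasoning
    regroup : ∀ q t → q * + 4 * (+ 1 + t * + 2 - + 1) ≡ t * (q * + 8)
    regroup = solve-∀

  n∣P₃ : + n ∣ᶻ a₀ * (+ 1 - + b) + + 2 - + b + + a
  n∣P₃ = subst (+ n ∣ᶻ_) eq (ℤ∣.∣m∣n⇒∣m+n (ℤ∣.∣m⇒∣-m n∣X) n∣4q[b₀-1])
    where
    open ≡-Reasoning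
    P₃ : ℤ → ℤ → ℤ
    P₃ a b = a₀ * (+ 1 - b) + + 2 - b + a
    expand : ∀ b₀ q → - (+ 4 * b₀ * b₀ - + 4) + q * + 4 * (b₀ - + 1) ≡
                      (b₀ - q) * (+ 1 - (+ 1 + b₀ * + 4)) + + 2 - (+ 1 + b₀ * + 4) + (+ 3 + (b₀ - q) * + 4)
    expand = solve-∀
    eq : - X + + q * + 4 * (+ b₀ - + 1) ≡ P₃ (+ a) (+ b)
    eq = begin
      - X + + q * + 4 * (+ b₀ - + 1)              ≡⟨ expand (+ b₀) (+ q) ⟩
      P₃ (+ 3 + a₀ * + 4) (+ 1 + + b₀ * + 4)      ≡⟨ sym (cong₂ P₃ +a≡ +b≡) ⟩
      P₃ (+ a) (+ b)                              ∎

a+b<n : ∀ {n a b} → a ℕ.< b ℕ.∸ 2 → b ℕ.∸ 2 ℕ.< n ℕ.∸ a ℕ.∸ 2 → a ℕ.+ b ℕ.< n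
a+b<n {n} {a} {b} a<b-2 b-2<n-a-2 =
  subst (ℕ._< n) c+d≡a+b (ℕₚ.m≤o∸n⇒m+n≤o (suc c) d≤n c<n∸d)
  where
  c d : ℕ
  c = b ℕ.∸ 2
  d = a ℕ.+ 2
  c<n∸d : c ℕ.< n ℕ.∸ d
  c<n∸d = subst (c ℕ.<_) (ℕₚ.∸-+-assoc n a 2) b-2<n-a-2
  d≤n : d ℕ.≤ n
  d≤n = ℕₚ.<⇒≤ (ℕₚ.m∸n≢0⇒n<m (λ n∸d≡0 → ℕₚ.<⇒≱ c<n∸d (subst (ℕ._≤ c) (sym n∸d≡0) z≤n)))
  2≤b : 2 ℕ.≤ b
  2≤b = ℕₚ.<⇒≤ (ℕₚ.m∸n≢0⇒n<m (λ b∸2≡0 → ℕₚ.<⇒≱ a<b-2 (subst (ℕ._≤ a) (sym b∸2≡0) z≤n)))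
  c+d≡a+b : c ℕ.+ d ≡ a ℕ.+ b
  c+d≡a+b = trans (ℕₚ.+-comm c d) (trans (ℕₚ.+-assoc a 2 c)
              (cong (a ℕ.+_) (trans (ℕₚ.+-comm 2 c) (ℕₚ.m∸n+n≡m 2≤b))))

yPar≡b⊎yPar≡a : ∀ n a b .{{_ : NonZero n}} → (yPar n a b ≡ b × xPar n a b ≡ a) ⊎ (yPar n a b ≡ a × xPar n a b ≡ b)
yPar≡b⊎yPar≡a n a b with (+ a + (- + (((a ℕ.∸ 1) ℕ.* (b ℕ.∸ a)) ℕ./ 2))) ≡? + 1 [mod n ]
... | yes _ = inj₁ (refl , refl)
... | no _ = inj₂ (refl , refl)

-- [v₀, v_a] can only be the green inner edge leaving the even-indexed vertex v₀, so its stride yPar is a.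
colour-strides : ∀ n a b .{{_ : NonZero n}} → a ℕ.< b → b ℕ.< n → a ℕ.% 2 ≡ 1 →
                 MO.Gset n a b (MO.v0 n a b) (MO.vAt n a b a) → yPar n a b ≡ a × xPar n a b ≡ b
colour-strides n a b a<b b<n a%2≡1 v₀vₐ =
  [ (λ strides → ⊥-elim (not-green (proj₁ strides) v₀vₐ)) , (λ strides → strides) ]′ (yPar≡b⊎yPar≡a n a b)
  where
  open MO n a b
  a<n : a ℕ.< n
  a<n = ℕₚ.<-trans a<b b<n
  toℕ-mod : ∀ k → toℕ (k ℕ.mod n) ≡ k ℕ.% n
  toℕ-mod k = Finₚ.toℕ-fromℕ< _
  not-green : yPar n a b ≡ b → ¬ Gset v0 (vAt a)
  not-green _ (inj₁ (inj₁ (_ , _ , v₀≡ , _))) = flip≢ U (cong proj₁ v₀≡)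
  not-green _ (inj₂ (inj₁ (_ , _ , vₐ≡ , _))) = flip≢ U (cong proj₁ vₐ≡)
  not-green y≡b (inj₁ (inj₂ (j , _ , v₀≡ , vₐ≡))) = ℕₚ.<⇒≢ a<b (begin
    a                                ≡⟨ sym (ℕ.m<n⇒m%n≡m a<n) ⟩
    a ℕ.% n                          ≡⟨ sym (toℕ-mod a) ⟩
    toℕ (a ℕ.mod n)                  ≡⟨ trans (cong (λ v → toℕ (proj₂ v)) vₐ≡) (toℕ-mod (toℕ j ℕ.+ yPar n a b)) ⟩
    (toℕ j ℕ.+ yPar n a b) ℕ.% n     ≡⟨ cong₂ (λ i y → (i ℕ.+ y) ℕ.% n) j≡0 y≡b ⟩
    b ℕ.% n                          ≡⟨ ℕ.m<n⇒m%n≡m b<n ⟩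
    b                                ∎)
    where
    open ≡-Reasoning
    j≡0 : toℕ j ≡ 0
    j≡0 = trans (cong (λ v → toℕ (proj₂ v)) (sym v₀≡)) (trans (toℕ-mod 0) (ℕ.m<n⇒m%n≡m (ℕₚ.≤-<-trans z≤n a<n)))
  not-green _ (inj₂ (inj₂ (j , j-even , vₐ≡ , _))) = ℕₚ.1+n≢0 (trans (sym a%2≡1) (trans (cong (ℕ._% 2) a≡j) j-even))
    where
    a≡j : a ≡ toℕ j
    a≡j = trans (sym (ℕ.m<n⇒m%n≡m a<n)) (trans (sym (toℕ-mod a)) (cong (λ v → toℕ (proj₂ v)) vₐ≡))

RGExchange : (n a b : ℕ) .{{_ : NonZero n}} → Set
RGExchange n a b = ∃ λ (φ : MO.Automorphism n a b) → MO.HasOrder2 n a b φ ×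
  MO.MapsOnto n a b φ (MO.Gset n a b) (MO.Rset n a b) × MO.MapsOnto n a b φ (MO.Rset n a b) (MO.Gset n a b)

ArithmeticConditions : (n a b : ℕ) .{{_ : NonZero n}} → Set
ArithmeticConditions n a b = 8 ∣ n × (∃ λ b₀ → b ≡ 4 ℕ.* b₀ ℕ.+ 1 × Odd b₀ × 4 ℕ.* b ℕ.+ 4 ℕ.< 3 ℕ.* n ×
  (+ (4 ℕ.* b₀ ℕ.* b₀) ≡ + 4 [mod n ])) × a ℕ.+ n ℕ./ 2 ≡ b ℕ.+ 2

proposition8p7 : (n a b : ℕ) .{{_ : NonZero n}} → Feasible n a b → 1 ℕ.< a →
    MO.Gset n a b (MO.v0 n a b) (MO.vAt n a b a) →
    (∃ λ (φ : MO.Automorphism n a b) → MO.HasOrder2 n a b φ ×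
        MO.MapsOnto n a b φ (MO.Gset n a b) (MO.Rset n a b) ×
        MO.MapsOnto n a b φ (MO.Rset n a b) (MO.Gset n a b))
    ⇔ (8 ∣ n × (∃ λ b₀ → b ≡ 4 ℕ.* b₀ ℕ.+ 1 × Odd b₀ × 4 ℕ.* b ℕ.+ 4 ℕ.< 3 ℕ.* n ×
        (+ (4 ℕ.* b₀ ℕ.* b₀) ≡ + 4 [mod n ])) × a ℕ.+ n ℕ./ 2 ≡ b ℕ.+ 2)
proposition8p7 n a b (n%2≡0 , 4≤n , a%2≡1 , b%2≡1 , _ , a<b , b<n , _ , _ , _ , _ , a<b-2 , b-2<n-a-2) _ v₀vₐ =
  mk⇔ necessary sufficient
  where
  strides : yPar n a b ≡ a × xPar n a b ≡ b
  strides = colour-strides n a b a<b b<n a%2≡1 v₀vₐ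
  2<n : 2 ℕ.< n
  2<n = ℕₚ.<-≤-trans (s≤s (s≤s (s≤s z≤n))) 4≤n
  necessary : RGExchange n a b → ArithmeticConditions n a b
  necessary (φ , _ , G↦R , R↦G) = A.8∣n , (N.b₀ , A.b≡4b₀+1 , A.b₀-odd , A.4b+4<3n , A.4b₀²≡4) , A.a+n/2≡b+2
    where
    module N = Necessity n a b n%2≡0 a%2≡1 b%2≡1 (proj₁ strides) (proj₂ strides) 2<n a<b b<n φ G↦R R↦G
    module A = Arithmetic n N.m a b N.a₀ N.b₀ N.+n≡m*4 N.+b≡ N.+a≡ a<b b<n (a+b<n a<b-2 b-2<n-a-2)
                          (proj₁ N.n∣P) (proj₁ (proj₂ N.n∣P)) (proj₂ (proj₂ N.n∣P))
  sufficient : ArithmeticConditions n a b → RGExchange n a b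
  sufficient (divides q n≡q*8 , (b₀ , b≡ , b₀-odd , _ , 4b₀²≡4) , a+n/2≡b+2) =
    S.automorphism , S.order-two , S.swaps-classes green , S.swaps-classes red
    where
    module C = Converse n a b q b₀ n≡q*8 b≡ b₀-odd 4b₀²≡4 a+n/2≡b+2
    module S = Sufficiency n a b n%2≡0 a%2≡1 b%2≡1 (proj₁ strides) (proj₂ strides)
                           q b₀ C.a₀ C.+n≡q*8 C.+b≡ C.+a≡ C.n∣P₁ C.n∣P₂ C.n∣P₃
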